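{- Let $G$ be a looped simple graph and $M$ a binary matroid. The following are equivalent: (1) $M$ is isomorphic to $M(IAS(H))$ for some graph $H$ obtained from $G$ through some sequence of local complementations (simple or non-simple), loop complementations and vertex deletions; (2) $M$ is isomorphic to a minor of $M(IAS(G))$ obtained by removing some cells of the canonical partition, each removed cell being removed by contracting one of its elements and deleting the other two.
   Context: A looped simple graph is a finite graph in which each vertex may carry at most one loop and distinct non-loop edges join distinct pairs of vertices; $N(v)$ is the set of neighbors of $v$ other than $v$. $A(G)$ is the adjacency matrix over $GF(2)$ (diagonal $1$ iff looped). $M(IAS(G))$ is the binary matroid represented by the columns of $(I\mid A(G)\mid I+A(G))$; its ground set consists of columns $v_\phi,v_\chi,v_\psi$ (the columns of $v$ in $I$, $A(G)$, $I+A(G)$), and the canonical partition has cells $\{v_\phi,v_\chi,v_\psi\}$, $v\in V(G)$. Loop complementation at $v$ reverses the loop status of $v$. The simple local complement $G^v_s$ complements all adjacencies between distinct elements of $N(v)$; the non-simple local complement $G^v_{ns}$ is obtained from $G^v_s$ by also reversing the loop status of each element of $N(v)$. -}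

module Defs where

open import Data.Bool using (Bool; true; false; _∧_; _xor_; not; if_then_else_)
open import Data.Nat using (ℕ; zero; suc; _<_)
open import Data.Fin using (Fin; punchIn)
open import Data.Fin.Properties using (_≟_)
open import Data.List using (List; []; _∷_; foldr; map; concatMap; length; filter)
open import Data.List using (allFin)
open import Data.Product using (Σ; _×_; _,_; ∃)
open import Relation.Nullary using (¬_)
open import Relation.Nullary.Decidable using (⌊_⌋)
open import Relation.Binary.PropositionalEquality using (_≡_)

Sub : Set → Set
Sub E = E → Bool

_⊆_ : {E : Set} → Sub E → Sub E → Set
S ⊆ T = ∀ e → S e ≡ true → T e ≡ true

_∪_ : {E : Set} → Sub E → Sub E → Sub E
(S ∪ T) e = if S e then true else T e

∅ : {E : Set} → Sub E
∅ _ = false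

-- A family of columns col : E → (Fin k → Bool), E enumerated by the list es
-- (each element exactly once).

sumCols : {E : Set} {k : ℕ} → List E → (E → Fin k → Bool) → Sub E → Fin k → Bool
sumCols es col T w = foldr (λ e acc → (T e ∧ col e w) xor acc) false es

LinIndep : {E : Set} {k : ℕ} → List E → (E → Fin k → Bool) → Sub E → Set
LinIndep es col S =
  ∀ T → T ⊆ S → (∀ w → sumCols es col T w ≡ false) → ∀ e → T e ≡ false

card : {m : ℕ} → Sub (Fin m) → ℕ
card {m} S = length (filter (λ i → S i Data.Bool.≟ true) (allFin m))
  where import Data.Bool

insert : {m : ℕ} → Fin m → Sub (Fin m) → Sub (Fin m)
insert e S i = if ⌊ i ≟ e ⌋ then true else S i

record Matroid : Set₁ where
  field
    size     : ℕ
    Indep    : Sub (Fin size) → Set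
    indep-∅  : Indep ∅
    indep-⊆  : ∀ I J → J ⊆ I → Indep I → Indep J
    exchange : ∀ I J → Indep I → Indep J → card I < card J →
               ∃ λ e → J e ≡ true × I e ≡ false × Indep (insert e I)

open Matroid public

IsBinary : Matroid → Set
IsBinary M = Σ ℕ λ k → Σ (Fin (size M) → Fin k → Bool) λ col →
  ∀ S → (Indep M S → LinIndep (allFin (size M)) col S)
      × (LinIndep (allFin (size M)) col S → Indep M S)

-- Looped simple graphs on vertex set Fin n, via their GF(2) adjacency
-- matrix (diagonal entry true iff the vertex is looped).

Graph : ℕ → Set
Graph n = Fin n → Fin n → Bool

IsLoopedSimple : {n : ℕ} → Graph n → Set
IsLoopedSimple A = ∀ i j → A i j ≡ A j i

eqb : {n : ℕ} → Fin n → Fin n → Bool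
eqb i j = ⌊ i ≟ j ⌋

inN : {n : ℕ} → Graph n → Fin n → Fin n → Bool
inN A v i = A v i ∧ not (eqb i v)

loopCompl : {n : ℕ} → Fin n → Graph n → Graph n
loopCompl v A i j = A i j xor (eqb i v ∧ eqb j v)

localComplS : {n : ℕ} → Fin n → Graph n → Graph n
localComplS v A i j = A i j xor (inN A v i ∧ inN A v j ∧ not (eqb i j))

localComplNS : {n : ℕ} → Fin n → Graph n → Graph n
localComplNS v A i j = A i j xor (inN A v i ∧ inN A v j)

deleteV : {n : ℕ} → Fin (suc n) → Graph (suc n) → Graph n
deleteV v A i j = A (punchIn v i) (punchIn v j)

data Reach {n : ℕ} (G : Graph n) : (m : ℕ) → Graph m → Set where
  start : Reach G n G
  lc-s  : ∀ {m H} → Reach G m H → (v : Fin m) → Reach G m (localComplS v H)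
  lc-ns : ∀ {m H} → Reach G m H → (v : Fin m) → Reach G m (localComplNS v H)
  loopc : ∀ {m H} → Reach G m H → (v : Fin m) → Reach G m (loopCompl v H)
  del   : ∀ {m H} → Reach G (suc m) H → (v : Fin (suc m)) → Reach G m (deleteV v H)

-- The isotropic matroid M(IAS(G)): columns of (I | A(G) | I + A(G)).

data Lbl : Set where
  φ χ ψ : Lbl

lbls : List Lbl
lbls = φ ∷ χ ∷ ψ ∷ []

-- ground set: element (v , φ) is v_φ, etc.
Elt : ℕ → Set
Elt n = Fin n × Lbl

elts : (n : ℕ) → List (Elt n)
elts n = concatMap (λ v → map (λ t → (v , t)) lbls) (allFin n)

iasCol : {n : ℕ} → Graph n → Elt n → Fin n → Bool
iasCol A (v , φ) w = eqb w v
iasCol A (v , χ) w = A w v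
iasCol A (v , ψ) w = eqb w v xor A w v

IASIndep : {n : ℕ} → Graph n → Sub (Elt n) → Set
IASIndep {n} A = LinIndep (elts n) (iasCol A)

IsoTo : Matroid → {E : Set} → Sub E → (Sub E → Set) → Set
IsoTo M {E} X P = Σ (Fin (size M) → E) λ f →
    (∀ i j → f i ≡ f j → i ≡ j)
  × (∀ i → X (f i) ≡ true)
  × (∀ e → X e ≡ true → ∃ λ i → f i ≡ e)
  × (∀ T → T ⊆ X → (P T → Indep M (λ i → T (f i)))
                 × (Indep M (λ i → T (f i)) → P T))

IsoIAS : Matroid → {m : ℕ} → Graph m → Set
IsoIAS M {m} H = IsoTo M {Elt m} (λ _ → true) (IASIndep H)

IsBasisOf : {E : Set} → (Sub E → Set) → Sub E → Sub E → Set
IsBasisOf Ind C B = B ⊆ C × Ind B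
  × (∀ B' → B ⊆ B' → B' ⊆ C → Ind B' → B' ⊆ B)

ContrIndep : {E : Set} → (Sub E → Set) → Sub E → Sub E → Set
ContrIndep Ind C I = ∃ λ B → IsBasisOf Ind C B × Ind (I ∪ B)

eqLbl : Lbl → Lbl → Bool
eqLbl φ φ = true
eqLbl χ χ = true
eqLbl ψ ψ = true
eqLbl _ _ = false

-- Removing the cells of the vertices in R, the cell of v being removed by
-- contracting v_(c v) and deleting the other two elements of the cell.
contracted : {n : ℕ} → Sub (Fin n) → (Fin n → Lbl) → Sub (Elt n)
contracted R c (v , t) = R v ∧ eqLbl t (c v)

deleted : {n : ℕ} → Sub (Fin n) → (Fin n → Lbl) → Sub (Elt n)
deleted R c (v , t) = R v ∧ not (eqLbl t (c v))

remaining : {n : ℕ} → Sub (Fin n) → Sub (Elt n)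
remaining R (v , t) = not (R v)

-- Independence in the minor  M(IAS(G)) / contracted \ deleted,
-- whose ground set is  remaining R  (deletion = restriction).
MinorIndep : {n : ℕ} → Graph n → Sub (Fin n) → (Fin n → Lbl) → Sub (Elt n) → Set
MinorIndep G R c I = ContrIndep (IASIndep G) (contracted R c) I

IsoMinor : Matroid → {n : ℕ} → Graph n → Sub (Fin n) → (Fin n → Lbl) → Set
IsoMinor M {n} G R c = IsoTo M {Elt n} (remaining R) (MinorIndep G R c)

-- Write M(IAS(H)) as the columns of (I | A | I + A), grouped into cells {v_φ, v_χ, v_ψ}.
-- A local or loop complementation at v changes these columns, cell by cell and up to
-- permuting the labels within a cell, by the invertible transvection x ↦ x + x(v)·N(v)
-- (N(v) = 0 for a loop complementation), so it preserves the matroid up to relabelling.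
-- Deleting v from H contracts v_φ, whose column is the unit vector of v, and deletes v_χ,
-- v_ψ; if v is isolated, one of v_χ, v_ψ is a loop, and contracting it instead also amounts
-- to deleting v. Hence every graph reachable from G realises a minor of M(IAS(G)) of the
-- stated form. Conversely, to remove the cell of v by contracting a prescribed element,
-- complement at v, or at a neighbour of v and then at v, until that element is v_φ, or,
-- if v is isolated, a loop; then delete v.

module Submission where

open import Defs
open import Algebra.Bundles using (CommutativeRing)
open import Data.Bool using (Bool; true; false; _∧_; _∨_; _xor_; not; if_then_else_)
open import Data.Bool.ListAction using (any)
open import Data.Bool.Properties
  using (xor-∧-commutativeRing; xor-assoc; xor-comm; xor-identityʳ; xor-same; ∧-comm; ∧-zeroʳ; ∧-identityʳ;
         ∧-conicalʳ; ∨-zeroʳ; ∨-identityʳ; ∨-conicalˡ; ∨-conicalʳ; not-involutive; not-¬; ¬-not)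
  renaming (_≟_ to _≟ᴮ_)
open import Data.Empty using (⊥-elim)
open import Data.Fin using (Fin; zero; suc; punchIn; punchOut)
open import Data.Fin.Properties
  using (_≟_; all?; any?; punchIn-injective; punchInᵢ≢i; punchIn-punchOut; punchOut-punchIn; punchOut-cong)
open import Data.List using (List; []; _∷_; map; concatMap; tabulate; _++_; allFin)
open import Data.List.Membership.Propositional using (_∈_)
open import Data.List.Membership.Propositional.Properties using (∈-allFin; ∈-map⁺; ∈-concat⁺′)
open import Data.List.Relation.Unary.Any using (here; there)
open import Data.Maybe using (just; nothing)
open import Data.Nat using (ℕ; zero; suc)
open import Data.Product using (Σ; ∃; _×_; _,_; proj₁; proj₂)
open import Data.Product.Properties using (≡-dec)
open import Data.Sum using (_⊎_; inj₁; inj₂; [_,_]′)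
open import Function using (_∘_; id; _⟨_⟩_)
open import Level using (0ℓ)
open import Relation.Binary.Definitions using (DecidableEquality)
open import Relation.Binary.PropositionalEquality
open import Relation.Nullary using (¬_; Dec; yes; no)
open import Relation.Nullary.Decidable using (⌊_⌋; isYes≗does; dec-true; dec-false; map′; _→-dec_; _×-dec_)
open import Tactic.RingSolver using (solve-∀)
open import Tactic.RingSolver.Core.AlmostCommutativeRing using (AlmostCommutativeRing; fromCommutativeRing)

open import Algebra.Properties.Semiring.Sum (CommutativeRing.semiring xor-∧-commutativeRing)
  using (sum; sum-remove; sum-cong-≗; sum-replicate-zero)

xor-∧-ring : AlmostCommutativeRing 0ℓ 0ℓ
xor-∧-ring = fromCommutativeRing xor-∧-commutativeRing λ { false → just refl ; true → nothing }

∧-not-xor-∧ : ∀ a c → (a ∧ not c) xor (a ∧ c) ≡ a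
∧-not-xor-∧ true true = refl
∧-not-xor-∧ true false = refl
∧-not-xor-∧ false c = refl

xor-cancelʳ : ∀ a b → (a xor b) xor b ≡ a
xor-cancelʳ = solve-∀ xor-∧-ring

xor-cancelˡ : ∀ a b → a xor (a xor b) ≡ b
xor-cancelˡ = solve-∀ xor-∧-ring

xor-comm-cancel : ∀ a b → (a xor b) xor a ≡ b
xor-comm-cancel = solve-∀ xor-∧-ring

if-true-false : ∀ b → (if b then true else false) ≡ b
if-true-false true = refl
if-true-false false = refl

module _ {A : Set} (_≟ᴬ_ : DecidableEquality A) where

  ⌊≟⌋-refl : ∀ a → ⌊ a ≟ᴬ a ⌋ ≡ true
  ⌊≟⌋-refl a = trans (isYes≗does (a ≟ᴬ a)) (dec-true (a ≟ᴬ a) refl)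

  ⌊≟⌋-true : ∀ {a b} → ⌊ a ≟ᴬ b ⌋ ≡ true → a ≡ b
  ⌊≟⌋-true {a} {b} p with a ≟ᴬ b
  ... | yes a≡b = a≡b

  ⌊≟⌋-false : ∀ {a b} → a ≢ b → ⌊ a ≟ᴬ b ⌋ ≡ false
  ⌊≟⌋-false {a} {b} a≢b = trans (isYes≗does (a ≟ᴬ b)) (dec-false (a ≟ᴬ b) a≢b)

eqb-refl : ∀ {n} (i : Fin n) → eqb i i ≡ true
eqb-refl = ⌊≟⌋-refl _≟_

eqb-true : ∀ {n} {i j : Fin n} → eqb i j ≡ true → i ≡ j
eqb-true = ⌊≟⌋-true _≟_

eqb-false : ∀ {n} {i j : Fin n} → i ≢ j → eqb i j ≡ false
eqb-false = ⌊≟⌋-false _≟_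

eqb-false⁻¹ : ∀ {n} {i j : Fin n} → eqb i j ≡ false → i ≢ j
eqb-false⁻¹ {i = i} eq refl = not-¬ eq (eqb-refl i)

eqb-sym : ∀ {n} (i j : Fin n) → eqb i j ≡ eqb j i
eqb-sym i j with i ≟ j
... | yes refl = sym (eqb-refl i)
... | no i≢j = sym (eqb-false (i≢j ∘ sym))

eqb-∧-diag : ∀ {n} (f : Fin n → Bool) (i j : Fin n) → eqb i j ∧ f i ≡ eqb i j ∧ f j
eqb-∧-diag f i j with i ≟ j
... | yes refl = refl
... | no _ = refl

_≟ᴸ_ : DecidableEquality Lbl
φ ≟ᴸ φ = yes refl
χ ≟ᴸ χ = yes refl
ψ ≟ᴸ ψ = yes refl
φ ≟ᴸ χ = no λ ()
φ ≟ᴸ ψ = no λ ()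
χ ≟ᴸ φ = no λ ()
χ ≟ᴸ ψ = no λ ()
ψ ≟ᴸ φ = no λ ()
ψ ≟ᴸ χ = no λ ()

_≟ᴱ_ : ∀ {n} → DecidableEquality (Elt n)
_≟ᴱ_ = ≡-dec _≟_ _≟ᴸ_

_△_ : {E : Set} → Sub E → Sub E → Sub E
(S △ T) e = S e xor T e

_≐_ : {E : Set} → Sub E → Sub E → Set
S ≐ T = ∀ e → S e ≡ T e

Disjoint : {E : Set} → Sub E → Sub E → Set
Disjoint S T = ∀ e → S e ≡ true → T e ≡ false

⁅_⁆ : ∀ {n} → Elt n → Sub (Elt n)
⁅ x ⁆ e = ⌊ e ≟ᴱ x ⌋

∈⁅⁆ : ∀ {n} (x : Elt n) → ⁅ x ⁆ x ≡ true
∈⁅⁆ = ⌊≟⌋-refl _≟ᴱ_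

∈⁅⁆⇒≡ : ∀ {n} {x e : Elt n} → ⁅ x ⁆ e ≡ true → e ≡ x
∈⁅⁆⇒≡ = ⌊≟⌋-true _≟ᴱ_

∉⁅⁆ : ∀ {n} {x e : Elt n} → e ≢ x → ⁅ x ⁆ e ≡ false
∉⁅⁆ = ⌊≟⌋-false _≟ᴱ_

⁅⁆-⊆ : ∀ {n} {S : Sub (Elt n)} {x} → S x ≡ true → ⁅ x ⁆ ⊆ S
⁅⁆-⊆ {S = S} Sx e p = subst (λ y → S y ≡ true) (sym (∈⁅⁆⇒≡ p)) Sx

⁅⁆-same-vertex : ∀ {n} (u : Fin n) s t → ⁅ u , s ⁆ (u , t) ≡ eqLbl t s
⁅⁆-same-vertex u s t with t ≟ᴸ s
... | yes refl = trans (∈⁅⁆ (u , t)) (sym (eqLbl-refl t))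
  where
  eqLbl-refl : ∀ t → eqLbl t t ≡ true
  eqLbl-refl φ = refl
  eqLbl-refl χ = refl
  eqLbl-refl ψ = refl
... | no t≢s = trans (∉⁅⁆ (t≢s ∘ cong proj₂)) (sym (eqLbl-≢ t≢s))
  where
  eqLbl-≢ : ∀ {t s} → t ≢ s → eqLbl t s ≡ false
  eqLbl-≢ {φ} {φ} t≢s = ⊥-elim (t≢s refl)
  eqLbl-≢ {χ} {χ} t≢s = ⊥-elim (t≢s refl)
  eqLbl-≢ {ψ} {ψ} t≢s = ⊥-elim (t≢s refl)
  eqLbl-≢ {φ} {χ} _ = refl
  eqLbl-≢ {φ} {ψ} _ = refl
  eqLbl-≢ {χ} {φ} _ = refl
  eqLbl-≢ {χ} {ψ} _ = refl
  eqLbl-≢ {ψ} {φ} _ = refl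
  eqLbl-≢ {ψ} {χ} _ = refl

module _ {E : Set} where

  ⊆-refl : {S : Sub E} → S ⊆ S
  ⊆-refl _ p = p

  ⊆-trans : {S T U : Sub E} → S ⊆ T → T ⊆ U → S ⊆ U
  ⊆-trans S⊆T T⊆U e p = T⊆U e (S⊆T e p)

  ⊆-∪ˡ : (S T : Sub E) → S ⊆ (S ∪ T)
  ⊆-∪ˡ S T e p rewrite p = refl

  ⊆-∪ʳ : (S T : Sub E) → T ⊆ (S ∪ T)
  ⊆-∪ʳ S T e p with S e
  ... | true = refl
  ... | false = p

  ∪-elim : (S T : Sub E) (e : E) → (S ∪ T) e ≡ true → S e ≡ true ⊎ T e ≡ true
  ∪-elim S T e p with S e
  ... | true = inj₁ refl
  ... | false = inj₂ p

  ∪-right : (S T : Sub E) (e : E) → (S ∪ T) e ≡ true → S e ≡ false → T e ≡ true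
  ∪-right S T e p q with S e
  ... | false = p

  ∪-left : (S T : Sub E) (e : E) → (S ∪ T) e ≡ true → T e ≡ false → S e ≡ true
  ∪-left S T e p q with S e
  ... | true = refl
  ... | false = ⊥-elim (not-¬ q p)

  ∪-⊆ : {S T U : Sub E} → S ⊆ U → T ⊆ U → (S ∪ T) ⊆ U
  ∪-⊆ {S} {T} S⊆U T⊆U e p with ∪-elim S T e p
  ... | inj₁ q = S⊆U e q
  ... | inj₂ q = T⊆U e q

  △-elim : (S T : Sub E) (e : E) → (S △ T) e ≡ true → S e ≡ true ⊎ T e ≡ true
  △-elim S T e p with S e
  ... | true = inj₁ refl
  ... | false = inj₂ p

  △-⊆ : {S T U : Sub E} → S ⊆ U → T ⊆ U → (S △ T) ⊆ U
  △-⊆ {S} {T} S⊆U T⊆U e p with △-elim S T e p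
  ... | inj₁ q = S⊆U e q
  ... | inj₂ q = T⊆U e q

  ⊆-resolve : {S T U : Sub E} → U ⊆ (S ∪ T) → Disjoint S U → U ⊆ T
  ⊆-resolve {S} {T} {U} U⊆S∪T S∩U e p with ∪-elim S T e (U⊆S∪T e p)
  ... | inj₁ q = ⊥-elim (not-¬ (S∩U e q) p)
  ... | inj₂ q = q

  Disjoint-⊆ : {S T T' : Sub E} → Disjoint S T → T' ⊆ T → Disjoint S T'
  Disjoint-⊆ S∩T T'⊆T e Se = ¬-not (not-¬ (S∩T e Se) ∘ T'⊆T e)

  ⊆-≐ : {S T : Sub E} → S ≐ T → S ⊆ T
  ⊆-≐ S≐T e p = trans (sym (S≐T e)) p

module _ {E : Set} {k : ℕ} (col : E → Fin k → Bool) where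

  sumCols-cong : ∀ l {U V} → U ≐ V → ∀ w → sumCols l col U w ≡ sumCols l col V w
  sumCols-cong [] U≐V w = refl
  sumCols-cong (x ∷ l) U≐V w = cong₂ (λ a b → (a ∧ col x w) xor b) (U≐V x) (sumCols-cong l U≐V w)

  sumCols-cong-col : ∀ {k'} {col' : E → Fin k' → Bool} l U w w' → (∀ e → col e w ≡ col' e w') →
    sumCols l col U w ≡ sumCols l col' U w'
  sumCols-cong-col [] U w w' col≡ = refl
  sumCols-cong-col {col' = col'} (x ∷ l) U w w' col≡ =
    cong₂ (λ a b → (U x ∧ a) xor b) (col≡ x) (sumCols-cong-col {col' = col'} l U w w' col≡)

  sumCols-∅ : ∀ l w → sumCols l col ∅ w ≡ false
  sumCols-∅ [] w = refl
  sumCols-∅ (x ∷ l) w = sumCols-∅ l w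

  sumCols-△ : ∀ l U V w → sumCols l col (U △ V) w ≡ sumCols l col U w xor sumCols l col V w
  sumCols-△ [] U V w = refl
  sumCols-△ (x ∷ l) U V w = begin
    ((U x xor V x) ∧ col x w) xor sumCols l col (U △ V) w
      ≡⟨ cong (((U x xor V x) ∧ col x w) xor_) (sumCols-△ l U V w) ⟩
    ((U x xor V x) ∧ col x w) xor (sumCols l col U w xor sumCols l col V w)
      ≡⟨ regroup (U x) (V x) (col x w) _ _ ⟩
    ((U x ∧ col x w) xor sumCols l col U w) xor ((V x ∧ col x w) xor sumCols l col V w) ∎
    where
    open ≡-Reasoning
    regroup : ∀ a b c s t → ((a xor b) ∧ c) xor (s xor t) ≡ ((a ∧ c) xor s) xor ((b ∧ c) xor t)
    regroup = solve-∀ xor-∧-ring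

  sumCols-++ : ∀ l l' U w → sumCols (l ++ l') col U w ≡ sumCols l col U w xor sumCols l' col U w
  sumCols-++ [] l' U w = refl
  sumCols-++ (x ∷ l) l' U w =
    trans (cong ((U x ∧ col x w) xor_) (sumCols-++ l l' U w))
      (sym (xor-assoc (U x ∧ col x w) (sumCols l col U w) (sumCols l' col U w)))

cell : ∀ {n} → Fin n → List (Elt n)
cell v = map (λ t → (v , t)) lbls

cellSum : ∀ {n k} → (Elt n → Fin k → Bool) → Sub (Elt n) → Fin n → Fin k → Bool
cellSum col U v w = sumCols (cell v) col U w

sumCols-elts : ∀ {n k} (col : Elt n → Fin k → Bool) U w →
  sumCols (elts n) col U w ≡ sum (λ v → cellSum col U v w)
sumCols-elts {n} col U w = over id
  where
  over : ∀ {m} (f : Fin m → Fin n) →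
    sumCols (concatMap cell (tabulate f)) col U w ≡ sum (λ i → cellSum col U (f i) w)
  over {zero} f = refl
  over {suc m} f =
    trans (sumCols-++ col (cell (f zero)) (concatMap cell (tabulate (f ∘ suc))) U w)
          (cong (cellSum col U (f zero) w xor_) (over (f ∘ suc)))

cellSum-empty : ∀ {n k} (col : Elt n → Fin k → Bool) U v w →
  (∀ t → U (v , t) ≡ false) → cellSum col U v w ≡ false
cellSum-empty col U v w U∌ rewrite U∌ φ | U∌ χ | U∌ ψ = refl

cellSum-null-row : ∀ {n k} (col : Elt n → Fin k → Bool) U v w →
  (∀ t → col (v , t) w ≡ false) → cellSum col U v w ≡ false
cellSum-null-row col U v w col≡0 rewrite col≡0 φ | col≡0 χ | col≡0 ψ
  | ∧-zeroʳ (U (v , φ)) | ∧-zeroʳ (U (v , χ)) | ∧-zeroʳ (U (v , ψ)) = refl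

elts-complete : ∀ {n} (e : Elt n) → e ∈ elts n
elts-complete (v , t) = ∈-concat⁺′ (in-cell t) (∈-map⁺ cell (∈-allFin v))
  where
  in-cell : ∀ t → (v , t) ∈ cell v
  in-cell φ = here refl
  in-cell χ = there (here refl)
  in-cell ψ = there (there (here refl))

prependCell : ∀ {m} → Bool → Bool → Bool → Sub (Elt m) → Sub (Elt (suc m))
prependCell a b c U (zero , φ) = a
prependCell a b c U (zero , χ) = b
prependCell a b c U (zero , ψ) = c
prependCell a b c U (suc i , t) = U (i , t)

prependCell-cong : ∀ {m a b c} {U V : Sub (Elt m)} → U ≐ V → prependCell a b c U ≐ prependCell a b c V
prependCell-cong U≐V (zero , φ) = refl
prependCell-cong U≐V (zero , χ) = refl
prependCell-cong U≐V (zero , ψ) = refl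
prependCell-cong U≐V (suc i , t) = U≐V (i , t)

prependCell-restrict : ∀ {m} (U : Sub (Elt (suc m))) →
  U ≐ prependCell (U (zero , φ)) (U (zero , χ)) (U (zero , ψ)) (λ e → U (suc (proj₁ e) , proj₂ e))
prependCell-restrict U (zero , φ) = refl
prependCell-restrict U (zero , χ) = refl
prependCell-restrict U (zero , ψ) = refl
prependCell-restrict U (suc i , t) = refl

any-Bool? : {Q : Bool → Set} → (∀ b → Dec (Q b)) → Dec (∃ Q)
any-Bool? Q? with Q? true | Q? false
... | yes q | _ = yes (true , q)
... | no _ | yes q = yes (false , q)
... | no ¬qt | no ¬qf = no λ { (true , q) → ¬qt q ; (false , q) → ¬qf q }

all-Lbl? : {Q : Lbl → Set} → (∀ t → Dec (Q t)) → Dec (∀ t → Q t)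
all-Lbl? Q? with Q? φ | Q? χ | Q? ψ
... | yes p | yes q | yes r = yes λ { φ → p ; χ → q ; ψ → r }
... | no ¬p | _ | _ = no λ all → ¬p (all φ)
... | yes _ | no ¬q | _ = no λ all → ¬q (all χ)
... | yes _ | yes _ | no ¬r = no λ all → ¬r (all ψ)

search-Sub : ∀ n (P : Sub (Elt n) → Set) → (∀ {U V} → U ≐ V → P U → P V) →
  (∀ U → Dec (P U)) → Dec (∃ P)
search-Sub zero P resp P? with P? ∅
... | yes p = yes (∅ , p)
... | no ¬p = no λ (U , pU) → ¬p (resp (λ { (() , _) }) pU)
search-Sub (suc m) P resp P? =
  map′ (λ (a , b , c , U , p) → prependCell a b c U , p)
       (λ (U , p) → _ , _ , _ , _ , resp (prependCell-restrict U) p)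
       (any-Bool? λ a → any-Bool? λ b → any-Bool? λ c →
         search-Sub m (P ∘ prependCell a b c) (resp ∘ prependCell-cong) (P? ∘ prependCell a b c))

⊆? : ∀ {n} (S T : Sub (Elt n)) → Dec (S ⊆ T)
⊆? S T = map′ (λ all e → all (proj₁ e) (proj₂ e)) (λ S⊆T v t → S⊆T (v , t))
  (all? λ v → all-Lbl? λ t → (S (v , t) ≟ᴮ true) →-dec (T (v , t) ≟ᴮ true))

sum-single : ∀ {n} (f : Fin n → Bool) v → (∀ u → u ≢ v → f u ≡ false) → sum f ≡ f v
sum-single {suc n} f v others = begin
  sum f                               ≡⟨ sum-remove {i = v} f ⟩
  f v xor sum (λ i → f (punchIn v i)) ≡⟨ cong (f v xor_) (trans (sum-cong-≗ λ i → others _ (punchInᵢ≢i v i))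
                                                                  (sum-replicate-zero n)) ⟩
  f v xor false                       ≡⟨ xor-identityʳ (f v) ⟩
  f v                                 ∎
  where open ≡-Reasoning

-- Spans, independence and contraction for columns indexed by M(IAS)

module Columns {n k : ℕ} (col : Elt n → Fin k → Bool) where

  total : Sub (Elt n) → Fin k → Bool
  total U = sumCols (elts n) col U

  SumsToZero : Sub (Elt n) → Set
  SumsToZero U = ∀ w → total U w ≡ false

  Independent : Sub (Elt n) → Set
  Independent = LinIndep (elts n) col

  InSpan : Sub (Elt n) → (Fin k → Bool) → Set
  InSpan B t = Σ (Sub (Elt n)) λ V → V ⊆ B × (∀ w → total V w ≡ t w)

  Spans : Sub (Elt n) → Sub (Elt n) → Set
  Spans B C = ∀ c → C c ≡ true → InSpan B (col c)

  -- Independence of T in the contraction by C, phrased without choosing a basis of C.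
  IndepModulo : Sub (Elt n) → Sub (Elt n) → Set
  IndepModulo C T = ∀ U → U ⊆ (T ∪ C) → SumsToZero U → Disjoint T U

  total-cong : ∀ {U V} → U ≐ V → ∀ w → total U w ≡ total V w
  total-cong = sumCols-cong col (elts n)

  total-△ : ∀ U V w → total (U △ V) w ≡ total U w xor total V w
  total-△ = sumCols-△ col (elts n)

  cellSum-⁅⁆ : ∀ v t w → cellSum col ⁅ v , t ⁆ v w ≡ col (v , t) w
  cellSum-⁅⁆ v t w rewrite ⁅⁆-same-vertex v t φ | ⁅⁆-same-vertex v t χ | ⁅⁆-same-vertex v t ψ with t
  ... | φ = xor-identityʳ _
  ... | χ = xor-identityʳ _
  ... | ψ = xor-identityʳ _

  total-⁅⁆ : ∀ x w → total ⁅ x ⁆ w ≡ col x w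
  total-⁅⁆ (v , t) w = begin
    total ⁅ v , t ⁆ w                   ≡⟨ sumCols-elts col ⁅ v , t ⁆ w ⟩
    sum (λ u → cellSum col ⁅ v , t ⁆ u w) ≡⟨ sum-single _ v other-cell ⟩
    cellSum col ⁅ v , t ⁆ v w            ≡⟨ cellSum-⁅⁆ v t w ⟩
    col (v , t) w                        ∎
    where
    open ≡-Reasoning
    other-cell : ∀ u → u ≢ v → cellSum col ⁅ v , t ⁆ u w ≡ false
    other-cell u u≢v = cellSum-empty col ⁅ v , t ⁆ u w λ _ → ∉⁅⁆ (u≢v ∘ cong proj₁)

  total-∅ : ∀ w → total ∅ w ≡ false
  total-∅ = sumCols-∅ col (elts n)

  total-⁅⁆-scaled : ∀ b x w → total (λ e → b ∧ ⁅ x ⁆ e) w ≡ b ∧ col x w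
  total-⁅⁆-scaled true x w = total-⁅⁆ x w
  total-⁅⁆-scaled false x w = total-∅ w

  span-zero : ∀ B → InSpan B (λ _ → false)
  span-zero B = ∅ , (λ _ ()) , total-∅

  span-⁅⁆ : ∀ {B} x → B x ≡ true → InSpan B (col x)
  span-⁅⁆ x Bx = ⁅ x ⁆ , ⁅⁆-⊆ Bx , total-⁅⁆ x

  span-mono : ∀ {B B' t} → B ⊆ B' → InSpan B t → InSpan B' t
  span-mono B⊆B' (V , V⊆B , sumV) = V , ⊆-trans V⊆B B⊆B' , sumV

  span-xor : ∀ {B t s} → InSpan B t → InSpan B s → InSpan B (λ w → t w xor s w)
  span-xor (V , V⊆B , sumV) (W , W⊆B , sumW) =
    V △ W , △-⊆ V⊆B W⊆B , λ w → trans (total-△ V W w) (cong₂ _xor_ (sumV w) (sumW w))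

  span-sumCols : ∀ {B} V → Spans B V → ∀ l → InSpan B (sumCols l col V)
  span-sumCols {B} V B-spans-V [] = span-zero B
  span-sumCols V B-spans-V (x ∷ l) with V x in Vx
  ... | true = span-xor (B-spans-V x Vx) (span-sumCols V B-spans-V l)
  ... | false = span-sumCols V B-spans-V l

  span? : ∀ B t → Dec (InSpan B t)
  span? B t = search-Sub n (λ V → V ⊆ B × (∀ w → total V w ≡ t w)) respects-≐
    λ V → ⊆? V B ×-dec all? λ w → total V w ≟ᴮ t w
    where
    respects-≐ : ∀ {U V} → U ≐ V →
      U ⊆ B × (∀ w → total U w ≡ t w) → V ⊆ B × (∀ w → total V w ≡ t w)
    respects-≐ U≐V (U⊆B , sumU) =
      ⊆-trans (⊆-≐ (sym ∘ U≐V)) U⊆B , λ w → trans (sym (total-cong U≐V w)) (sumU w)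

  Independent-∅ : Independent ∅
  Independent-∅ U U⊆∅ _ e = ¬-not (λ Ue → not-¬ refl (U⊆∅ e Ue))

  Independent-⊆ : ∀ {S S'} → S' ⊆ S → Independent S → Independent S'
  Independent-⊆ S'⊆S indS U U⊆S' = indS U (⊆-trans U⊆S' S'⊆S)

  Independent⇒IndepModulo : ∀ {C T} → Independent (T ∪ C) → IndepModulo C T
  Independent⇒IndepModulo ind U U⊆ null e _ = ind U U⊆ null e

  Independent⇒IndepModulo∅ : ∀ {T} → Independent T → IndepModulo ∅ T
  Independent⇒IndepModulo∅ ind = Independent⇒IndepModulo (Independent-⊆ (∪-⊆ ⊆-refl λ _ ()) ind)

  IndepModulo∅⇒Independent : ∀ {T} → IndepModulo ∅ T → Independent T
  IndepModulo∅⇒Independent {T} mod U U⊆T null e =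
    ¬-not λ Ue → not-¬ (mod U (⊆-trans U⊆T (⊆-∪ˡ T ∅)) null e (U⊆T e Ue)) Ue

  Independent-∪ : ∀ {C T} → Independent C → IndepModulo C T → Independent (T ∪ C)
  Independent-∪ indC mod U U⊆T∪C null = indC U (⊆-resolve U⊆T∪C (mod U U⊆T∪C null)) null

  IndepModulo-mono : ∀ {C C' T} → C' ⊆ C → IndepModulo C T → IndepModulo C' T
  IndepModulo-mono {C} {C'} {T} C'⊆C mod U U⊆ =
    mod U (⊆-trans U⊆ (∪-⊆ (⊆-∪ˡ T C) (⊆-trans C'⊆C (⊆-∪ʳ T C))))

  unspanned⇒IndepModulo : ∀ {C x} → ¬ InSpan C (col x) → IndepModulo C ⁅ x ⁆
  unspanned⇒IndepModulo {C} {x} x∉span U U⊆ null e e∈⁅x⁆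
    rewrite ∈⁅⁆⇒≡ e∈⁅x⁆ = ¬-not λ Ux → x∉span (U △ ⁅ x ⁆ , U△x⊆C Ux , sum-U△x)
    where
    sum-U△x : ∀ w → total (U △ ⁅ x ⁆) w ≡ col x w
    sum-U△x w = trans (total-△ U ⁅ x ⁆ w) (cong₂ _xor_ (null w) (total-⁅⁆ x w))
    U△x⊆C : U x ≡ true → (U △ ⁅ x ⁆) ⊆ C
    U△x⊆C Ux e' p with e' ≟ᴱ x
    ... | yes refl rewrite Ux = ⊥-elim (not-¬ refl p)
    ... | no e'≢x = ∪-right ⁅ x ⁆ C e' (U⊆ e' (trans (sym (xor-identityʳ (U e'))) p)) (∉⁅⁆ e'≢x)

  -- The part of U inside C' is re-expressed through C; what is left is a
  -- dependency inside T ∪ C that agrees with U on T.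
  IndepModulo-span : ∀ {C C' T} → Disjoint T C → Disjoint T C' → Spans C C' →
    IndepModulo C T → IndepModulo C' T
  IndepModulo-span {C} {C'} {T} T∩C T∩C' C-spans-C' mod U U⊆ null e Te =
    trans (sym (Z≡U e Te)) (mod Z Z⊆ Z-null e Te)
    where
    inside outside : Sub (Elt n)
    inside e' = U e' ∧ C' e'
    outside e' = U e' ∧ not (C' e')
    inside-spanned : InSpan C (total inside)
    inside-spanned = span-sumCols inside (λ c p → C-spans-C' c (∧-conicalʳ _ _ p)) (elts n)
    S : Sub (Elt n)
    S = proj₁ inside-spanned
    S⊆C : S ⊆ C
    S⊆C = proj₁ (proj₂ inside-spanned)
    sum-S : ∀ w → total S w ≡ total inside w
    sum-S = proj₂ (proj₂ inside-spanned)
    Z : Sub (Elt n)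
    Z = outside △ S
    outside⊆T : outside ⊆ T
    outside⊆T e' p with U e' in Ue' | C' e' in C'e'
    ... | true | false = [ id , (λ C'e'≡t → ⊥-elim (not-¬ C'e' C'e'≡t)) ]′ (∪-elim T C' e' (U⊆ e' Ue'))
    ... | true | true = ⊥-elim (not-¬ refl p)
    ... | false | _ = ⊥-elim (not-¬ refl p)
    Z⊆ : Z ⊆ (T ∪ C)
    Z⊆ = △-⊆ (⊆-trans outside⊆T (⊆-∪ˡ T C)) (⊆-trans S⊆C (⊆-∪ʳ T C))
    Z-null : SumsToZero Z
    Z-null w = begin
      total Z w                                   ≡⟨ total-△ outside S w ⟩
      total outside w xor total S w               ≡⟨ cong (total outside w xor_) (sum-S w) ⟩
      total outside w xor total inside w          ≡⟨ sym (total-△ outside inside w) ⟩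
      total (outside △ inside) w                  ≡⟨ total-cong (λ e' → ∧-not-xor-∧ (U e') (C' e')) w ⟩
      total U w                                   ≡⟨ null w ⟩
      false                                       ∎
      where open ≡-Reasoning
    Z≡U : ∀ e → T e ≡ true → Z e ≡ U e
    Z≡U e Te rewrite T∩C' e Te | ¬-not (not-¬ (T∩C e Te) ∘ S⊆C e) =
      trans (xor-identityʳ _) (∧-identityʳ (U e))

  IndepModulo-contract : ∀ {C X T} → IndepModulo C X → IndepModulo (C ∪ X) T → IndepModulo C (T ∪ X)
  IndepModulo-contract {C} {X} {T} modX modT U U⊆ null e e∈T∪X =
    [ U∩T e , modX U U⊆X∪C null e ]′ (∪-elim T X e e∈T∪X)
    where
    U⊆T∪C∪X : U ⊆ (T ∪ (C ∪ X))
    U⊆T∪C∪X = ⊆-trans U⊆ (∪-⊆ (∪-⊆ (⊆-∪ˡ T (C ∪ X))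
                                   (⊆-trans (⊆-∪ʳ C X) (⊆-∪ʳ T (C ∪ X))))
                              (⊆-trans (⊆-∪ˡ C X) (⊆-∪ʳ T (C ∪ X))))
    U∩T : Disjoint T U
    U∩T = modT U U⊆T∪C∪X null
    U⊆X∪C : U ⊆ (X ∪ C)
    U⊆X∪C = ⊆-trans (⊆-resolve U⊆T∪C∪X U∩T) (∪-⊆ (⊆-∪ʳ X C) (⊆-∪ˡ X C))

  IndepModulo-uncontract : ∀ {C X T} → IndepModulo C (T ∪ X) → IndepModulo (C ∪ X) T
  IndepModulo-uncontract {C} {X} {T} mod U U⊆ null e Te = mod U (⊆-trans U⊆ rearrange) null e (⊆-∪ˡ T X e Te)
    where
    rearrange : (T ∪ (C ∪ X)) ⊆ ((T ∪ X) ∪ C)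
    rearrange = ∪-⊆ (⊆-trans (⊆-∪ˡ T X) (⊆-∪ˡ (T ∪ X) C))
                    (∪-⊆ (⊆-∪ʳ (T ∪ X) C) (⊆-trans (⊆-∪ʳ T X) (⊆-∪ˡ (T ∪ X) C)))

  greedy-basis : ∀ C (l : List (Elt n)) → Σ (Sub (Elt n)) λ B →
    B ⊆ C × Independent B × (∀ e → e ∈ l → C e ≡ true → InSpan B (col e))
  greedy-basis C [] = ∅ , (λ _ ()) , Independent-∅ , λ _ ()
  greedy-basis C (x ∷ l) with greedy-basis C l
  ... | B , B⊆C , indB , spans-l with C x in Cx
  ...   | false = B , B⊆C , indB ,
            λ { _ (here refl) Cx≡t → ⊥-elim (not-¬ Cx Cx≡t) ; e (there e∈l) → spans-l e e∈l }
  ...   | true with span? B (col x)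
  ...     | yes x∈span = B , B⊆C , indB , λ { _ (here refl) _ → x∈span ; e (there e∈l) → spans-l e e∈l }
  ...     | no x∉span =
              ⁅ x ⁆ ∪ B , ∪-⊆ (⁅⁆-⊆ Cx) B⊆C , Independent-∪ indB (unspanned⇒IndepModulo x∉span) ,
              λ { _ (here refl) _ → span-⁅⁆ x (⊆-∪ˡ ⁅ x ⁆ B x (∈⁅⁆ x))
                ; e (there e∈l) Ce → span-mono (⊆-∪ʳ ⁅ x ⁆ B) (spans-l e e∈l Ce) }

  basis : ∀ C → Σ (Sub (Elt n)) λ B → B ⊆ C × Independent B × Spans B C
  basis C with greedy-basis C (elts n)
  ... | B , B⊆C , indB , spans = B , B⊆C , indB , λ c → spans c (elts-complete c)

  spanning-maximal : ∀ {B C} → Spans B C → ∀ B' → B ⊆ B' → B' ⊆ C → Independent B' → B' ⊆ B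
  spanning-maximal {B} B-spans-C B' B⊆B' B'⊆C indB' e B'e with B e in Be
  ... | true = refl
  ... | false with B-spans-C e (B'⊆C e B'e)
  ...   | S , S⊆B , sum-S = ⊥-elim (not-¬ (indB' U U⊆B' U-null e) Ue)
    where
    U : Sub (Elt n)
    U = S △ ⁅ e ⁆
    U⊆B' : U ⊆ B'
    U⊆B' = △-⊆ (⊆-trans S⊆B B⊆B') (⁅⁆-⊆ B'e)
    U-null : SumsToZero U
    U-null w = trans (total-△ S ⁅ e ⁆ w) (trans (cong₂ _xor_ (sum-S w) (total-⁅⁆ e w)) (xor-same (col e w)))
    Ue : U e ≡ true
    Ue rewrite ¬-not (not-¬ Be ∘ S⊆B e) | ∈⁅⁆ e = refl

  basis-spans : ∀ {C B} → IsBasisOf Independent C B → Spans B C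
  basis-spans {C} {B} (B⊆C , indB , maximal) c Cc with span? B (col c)
  ... | yes c∈span = c∈span
  ... | no c∉span = ⊥-elim (c∉span (span-⁅⁆ c c∈B))
    where
    c∈B : B c ≡ true
    c∈B = maximal (⁅ c ⁆ ∪ B) (⊆-∪ʳ ⁅ c ⁆ B) (∪-⊆ (⁅⁆-⊆ Cc) B⊆C)
            (Independent-∪ indB (unspanned⇒IndepModulo c∉span)) c (⊆-∪ˡ ⁅ c ⁆ B c (∈⁅⁆ c))

  ContrIndep⇒IndepModulo : ∀ {C T} → Disjoint T C → ContrIndep Independent C T → IndepModulo C T
  ContrIndep⇒IndepModulo T∩C (B , isBasis@(B⊆C , _ , _) , indT∪B) =
    IndepModulo-span (Disjoint-⊆ T∩C B⊆C) T∩C (basis-spans isBasis) (Independent⇒IndepModulo indT∪B)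

  IndepModulo⇒ContrIndep : ∀ {C T} → IndepModulo C T → ContrIndep Independent C T
  IndepModulo⇒ContrIndep {C} mod with basis C
  ... | B , B⊆C , indB , spans =
    B , (B⊆C , indB , spanning-maximal spans) , Independent-∪ indB (IndepModulo-mono B⊆C mod)

  Independent-⁅⁆ : ∀ x w → col x w ≡ true → Independent ⁅ x ⁆
  Independent-⁅⁆ x w colxw U U⊆x null e =
    ¬-not λ Ue → not-¬ Ux (subst (λ y → U y ≡ true) (∈⁅⁆⇒≡ (U⊆x e Ue)) Ue)
    where
    U≐ : ∀ e → (U x ∧ ⁅ x ⁆ e) ≡ U e
    U≐ e with e ≟ᴱ x
    ... | yes refl = ∧-identityʳ (U x)
    ... | no e≢x = trans (∧-zeroʳ (U x)) (sym (¬-not λ Ue → not-¬ (∉⁅⁆ e≢x) (U⊆x e Ue)))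
    Ux : U x ≡ false
    Ux = begin
      U x                    ≡⟨ sym (∧-identityʳ (U x)) ⟩
      U x ∧ true             ≡⟨ cong (U x ∧_) (sym colxw) ⟩
      U x ∧ col x w          ≡⟨ sym (total-⁅⁆-scaled (U x) x w) ⟩
      total (λ e → U x ∧ ⁅ x ⁆ e) w ≡⟨ total-cong U≐ w ⟩
      total U w              ≡⟨ null w ⟩
      false                  ∎
      where open ≡-Reasoning

  null-column-dependent : ∀ x → (∀ w → col x w ≡ false) → ¬ Independent ⁅ x ⁆
  null-column-dependent x col≡0 ind =
    not-¬ (ind ⁅ x ⁆ ⊆-refl (λ w → trans (total-⁅⁆ x w) (col≡0 w)) x) (∈⁅⁆ x)

-- Relabelled cells and transvections x ↦ x + x(v)·a of GF(2)^m

data LabelSwap : Set where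
  noSwap φ↔χ φ↔ψ χ↔ψ : LabelSwap

swap : LabelSwap → Lbl → Lbl
swap noSwap l = l
swap φ↔χ φ = χ
swap φ↔χ χ = φ
swap φ↔χ ψ = ψ
swap φ↔ψ φ = ψ
swap φ↔ψ χ = χ
swap φ↔ψ ψ = φ
swap χ↔ψ φ = φ
swap χ↔ψ χ = ψ
swap χ↔ψ ψ = χ

swap-involutive : ∀ s l → swap s (swap s l) ≡ l
swap-involutive noSwap l = refl
swap-involutive φ↔χ φ = refl
swap-involutive φ↔χ χ = refl
swap-involutive φ↔χ ψ = refl
swap-involutive φ↔ψ φ = refl
swap-involutive φ↔ψ χ = refl
swap-involutive φ↔ψ ψ = refl
swap-involutive χ↔ψ φ = refl
swap-involutive χ↔ψ χ = refl
swap-involutive χ↔ψ ψ = refl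

relabel : ∀ {m} → (Fin m → LabelSwap) → Elt m → Elt m
relabel τ (u , l) = u , swap (τ u) l

relabel-involutive : ∀ {m} (τ : Fin m → LabelSwap) e → relabel τ (relabel τ e) ≡ e
relabel-involutive τ (u , l) = cong (u ,_) (swap-involutive (τ u) l)

sumLbl : (Lbl → Bool) → Bool
sumLbl f = f φ xor (f χ xor (f ψ xor false))

sumLbl-swap : ∀ s (f g : Lbl → Bool) →
  sumLbl (λ l → f l ∧ g (swap s l)) ≡ sumLbl (λ l → f (swap s l) ∧ g l)
sumLbl-swap noSwap f g = refl
sumLbl-swap φ↔χ f g = exchange₁₂ (f φ ∧ g χ) (f χ ∧ g φ) ((f ψ ∧ g ψ) xor false)
  where
  exchange₁₂ : ∀ a b c → a xor (b xor c) ≡ b xor (a xor c)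
  exchange₁₂ = solve-∀ xor-∧-ring
sumLbl-swap φ↔ψ f g = exchange₁₃ (f φ ∧ g ψ) (f χ ∧ g χ) (f ψ ∧ g φ)
  where
  exchange₁₃ : ∀ a b c → a xor (b xor (c xor false)) ≡ c xor (b xor (a xor false))
  exchange₁₃ = solve-∀ xor-∧-ring
sumLbl-swap χ↔ψ f g = exchange₂₃ (f φ ∧ g φ) (f χ ∧ g ψ) (f ψ ∧ g χ)
  where
  exchange₂₃ : ∀ a b c → a xor (b xor (c xor false)) ≡ a xor (c xor (b xor false))
  exchange₂₃ = solve-∀ xor-∧-ring

sumCols-relabel : ∀ {m k} (col : Elt m → Fin k → Bool) τ U w →
  sumCols (elts m) (col ∘ relabel τ) U w ≡ sumCols (elts m) col (U ∘ relabel τ) w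
sumCols-relabel {m} col τ U w = begin
  sumCols (elts m) (col ∘ relabel τ) U w
    ≡⟨ sumCols-elts (col ∘ relabel τ) U w ⟩
  sum (λ u → cellSum (col ∘ relabel τ) U u w)
    ≡⟨ sum-cong-≗ (λ u → sumLbl-swap (τ u) (λ l → U (u , l)) (λ l → col (u , l) w)) ⟩
  sum (λ u → cellSum col (U ∘ relabel τ) u w)
    ≡⟨ sym (sumCols-elts col (U ∘ relabel τ) w) ⟩
  sumCols (elts m) col (U ∘ relabel τ) w ∎
  where open ≡-Reasoning

transvect : ∀ {m} → Fin m → (Fin m → Bool) → (Fin m → Bool) → Fin m → Bool
transvect v a x w = x w xor (x v ∧ a w)

module _ {m : ℕ} (v : Fin m) (a : Fin m → Bool) where

  transvect-cong : ∀ {x y} → (∀ w → x w ≡ y w) → ∀ w → transvect v a x w ≡ transvect v a y w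
  transvect-cong x≡y w = cong₂ (λ p q → p xor (q ∧ a w)) (x≡y w) (x≡y v)

  transvect-xor : ∀ x y w →
    transvect v a (λ w → x w xor y w) w ≡ transvect v a x w xor transvect v a y w
  transvect-xor x y w = regroup (x w) (y w) (x v) (y v) (a w)
    where
    regroup : ∀ p q r s t → (p xor q) xor ((r xor s) ∧ t) ≡ (p xor (r ∧ t)) xor (q xor (s ∧ t))
    regroup = solve-∀ xor-∧-ring

  transvect-null : a v ≡ false → ∀ x → (∀ w → transvect v a x w ≡ false) → ∀ w → x w ≡ false
  transvect-null av≡f x null w = begin
    x w                ≡⟨ sym (xor-identityʳ (x w)) ⟩
    x w xor false      ≡⟨ cong (λ b → x w xor (b ∧ a w)) (sym xv≡f) ⟩
    transvect v a x w  ≡⟨ null w ⟩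
    false              ∎
    where
    open ≡-Reasoning
    xv≡f : x v ≡ false
    xv≡f = begin
      x v                       ≡⟨ sym (xor-identityʳ (x v)) ⟩
      x v xor false             ≡⟨ cong (x v xor_) (sym (∧-zeroʳ (x v))) ⟩
      x v xor (x v ∧ false)     ≡⟨ cong (λ b → x v xor (x v ∧ b)) (sym av≡f) ⟩
      transvect v a x v         ≡⟨ null v ⟩
      false                     ∎

  sumCols-transvect : ∀ {E : Set} (col : E → Fin m → Bool) l U w →
    sumCols l (λ e → transvect v a (col e)) U w ≡ transvect v a (sumCols l col U) w
  sumCols-transvect col [] U w = refl
  sumCols-transvect col (x ∷ l) U w =
    trans (cong ((U x ∧ transvect v a (col x) w) xor_) (sumCols-transvect col l U w))
          (regroup (U x) (col x w) (col x v) (a w) _ _)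
    where
    regroup : ∀ u c d t s r →
      (u ∧ (c xor (d ∧ t))) xor (s xor (r ∧ t)) ≡ ((u ∧ c) xor s) xor (((u ∧ d) xor r) ∧ t)
    regroup = solve-∀ xor-∧-ring

CellTransvects : ∀ {m} → Graph m → Graph m → Fin m → (Fin m → Bool) → Fin m → LabelSwap → Set
CellTransvects H H' v a u s = ∀ l w → iasCol H' (u , l) w ≡ transvect v a (iasCol H (u , swap s l)) w

TransvectsTo : ∀ {m} → Graph m → Graph m → Fin m → (Fin m → Bool) → (Fin m → LabelSwap) → Set
TransvectsTo H H' v a τ = ∀ u → CellTransvects H H' v a u (τ u)

module Transvected {m : ℕ} {H H' : Graph m} {v : Fin m} {a : Fin m → Bool} {τ : Fin m → LabelSwap}
  (H→H' : TransvectsTo H H' v a τ) (av≡f : a v ≡ false) where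

  open Columns (iasCol H) using () renaming (total to totalH; Independent to IndependentH; total-cong to totalH-cong)
  open Columns (iasCol H') using () renaming (total to totalH'; Independent to IndependentH')

  total-transvect : ∀ U w → totalH' U w ≡ transvect v a (totalH (U ∘ relabel τ)) w
  total-transvect U w = begin
    totalH' U w
      ≡⟨ sumCols-cong-col (iasCol H') {col' = λ e → transvect v a (iasCol H (relabel τ e))}
                          (elts m) U w w (λ (u , l) → H→H' u l w) ⟩
    sumCols (elts m) (λ e → transvect v a (iasCol H (relabel τ e))) U w
      ≡⟨ sumCols-transvect v a (iasCol H ∘ relabel τ) (elts m) U w ⟩
    transvect v a (sumCols (elts m) (iasCol H ∘ relabel τ) U) w
      ≡⟨ transvect-cong v a (sumCols-relabel (iasCol H) τ U) w ⟩
    transvect v a (totalH (U ∘ relabel τ)) w ∎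
    where open ≡-Reasoning

  Independent-transvect : ∀ S → IndependentH S → IndependentH' (S ∘ relabel τ)
  Independent-transvect S indS U U⊆ null e =
    trans (cong U (sym (relabel-involutive τ e))) (indS (U ∘ relabel τ) U∘ρ⊆S U∘ρ-null (relabel τ e))
    where
    U∘ρ⊆S : (U ∘ relabel τ) ⊆ S
    U∘ρ⊆S e p = subst (λ e' → S e' ≡ true) (relabel-involutive τ e) (U⊆ (relabel τ e) p)
    U∘ρ-null : ∀ w → totalH (U ∘ relabel τ) w ≡ false
    U∘ρ-null = transvect-null v a av≡f _ λ w → trans (sym (total-transvect U w)) (null w)

  Independent-untransvect : ∀ S → IndependentH' (S ∘ relabel τ) → IndependentH S
  Independent-untransvect S ind U U⊆S null e =
    trans (cong U (sym (relabel-involutive τ e)))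
          (ind (U ∘ relabel τ) (λ e → U⊆S (relabel τ e)) U∘ρ-null (relabel τ e))
    where
    U∘ρ-null : ∀ w → totalH' (U ∘ relabel τ) w ≡ false
    U∘ρ-null w = begin
      totalH' (U ∘ relabel τ) w
        ≡⟨ total-transvect (U ∘ relabel τ) w ⟩
      transvect v a (totalH (U ∘ relabel τ ∘ relabel τ)) w
        ≡⟨ transvect-cong v a (totalH-cong (cong U ∘ relabel-involutive τ)) w ⟩
      transvect v a (totalH U) w
        ≡⟨ cong₂ (λ p q → p xor (q ∧ a w)) (null w) (null v) ⟩
      false ∎
      where open ≡-Reasoning

-- Local and loop complementation transvect the isotropic columns

module _ {m : ℕ} {H H' : Graph m} {v : Fin m} {a : Fin m → Bool} where

  iasCol-swap-ψ : ∀ s u w → iasCol H (u , swap s ψ) w ≡ iasCol H (u , swap s φ) w xor iasCol H (u , swap s χ) w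
  iasCol-swap-ψ noSwap u w = refl
  iasCol-swap-ψ φ↔χ u w = xor-comm (eqb w u) (H w u)
  iasCol-swap-ψ φ↔ψ u w = sym (xor-cancelʳ (eqb w u) (H w u))
  iasCol-swap-ψ χ↔ψ u w = sym (xor-cancelˡ (eqb w u) (H w u))

  -- A cell is determined by its φ and χ columns, since ψ = φ + χ.
  cell-transvects : ∀ {u s} → (∀ w → transvect v a (iasCol H (u , swap s φ)) w ≡ eqb w u) →
    (∀ w → transvect v a (iasCol H (u , swap s χ)) w ≡ H' w u) → CellTransvects H H' v a u s
  cell-transvects hφ hχ φ w = sym (hφ w)
  cell-transvects hφ hχ χ w = sym (hχ w)
  cell-transvects {u} {s} hφ hχ ψ w = begin
    eqb w u xor H' w u
      ≡⟨ cong₂ _xor_ (sym (hφ w)) (sym (hχ w)) ⟩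
    transvect v a (iasCol H (u , swap s φ)) w xor transvect v a (iasCol H (u , swap s χ)) w
      ≡⟨ sym (transvect-xor v a (iasCol H (u , swap s φ)) (iasCol H (u , swap s χ)) w) ⟩
    transvect v a (λ w → iasCol H (u , swap s φ) w xor iasCol H (u , swap s χ) w) w
      ≡⟨ transvect-cong v a (λ w → sym (iasCol-swap-ψ s u w)) w ⟩
    transvect v a (iasCol H (u , swap s ψ)) w ∎
    where open ≡-Reasoning

  transvect-unit : ∀ {u} → u ≢ v → ∀ w → transvect v a (iasCol H (u , φ)) w ≡ eqb w u
  transvect-unit u≢v w rewrite eqb-false (u≢v ∘ sym) = xor-identityʳ _

  off-pivot-cell : ∀ {u} → u ≢ v → (∀ w → transvect v a (iasCol H (u , χ)) w ≡ H' w u) →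
    CellTransvects H H' v a u noSwap
  off-pivot-cell u≢v = cell-transvects {s = noSwap} (transvect-unit u≢v)

  off-pivot-cell-χ↔ψ : ∀ {u} → u ≢ v → (∀ w → transvect v a (iasCol H (u , ψ)) w ≡ H' w u) →
    CellTransvects H H' v a u χ↔ψ
  off-pivot-cell-χ↔ψ u≢v = cell-transvects {s = χ↔ψ} (transvect-unit u≢v)

inN-self : ∀ {m} (H : Graph m) v → inN H v v ≡ false
inN-self H v rewrite eqb-refl v = ∧-zeroʳ (H v v)

inN-other : ∀ {m} (H : Graph m) {v u} → u ≢ v → inN H v u ≡ H v u
inN-other H u≢v rewrite eqb-false u≢v = ∧-identityʳ _

column-pivot : ∀ {m} {H : Graph m} → IsLoopedSimple H → ∀ v w → H w v ≡ inN H v w xor (eqb w v ∧ H v v)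
column-pivot {H = H} sy v w with w ≟ v
... | yes refl = sym (cong (_xor H v v) (∧-zeroʳ (H v v)))
... | no w≢v = begin
  H w v                       ≡⟨ sy w v ⟩
  H v w                       ≡⟨ sym (∧-identityʳ (H v w)) ⟩
  H v w ∧ true                ≡⟨ sym (xor-identityʳ _) ⟩
  (H v w ∧ true) xor false    ∎
  where open ≡-Reasoning

pivotSwap : Bool → LabelSwap
pivotSwap true = φ↔χ
pivotSwap false = φ↔ψ

pivot-cell : ∀ {m} {H H' : Graph m} {v} → IsLoopedSimple H → (∀ w → H' w v ≡ H w v) →
  CellTransvects H H' v (inN H v) v (pivotSwap (H v v))
pivot-cell {H = H} {H'} {v} sy keep with H v v in loop
... | true = cell-transvects {H = H} {H'} {v} {inN H v} {v} {φ↔χ} hφ hχ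
  where
  open ≡-Reasoning
  column : ∀ w → H w v ≡ inN H v w xor eqb w v
  column w = trans (column-pivot sy v w) (cong (λ b → inN H v w xor (eqb w v ∧ b)) loop ⟨ trans ⟩
                                          cong (inN H v w xor_) (∧-identityʳ (eqb w v)))
  hφ : ∀ w → transvect v (inN H v) (λ w → H w v) w ≡ eqb w v
  hφ w = begin
    H w v xor (H v v ∧ inN H v w)            ≡⟨ cong₂ (λ p q → p xor (q ∧ inN H v w)) (column w) loop ⟩
    (inN H v w xor eqb w v) xor inN H v w    ≡⟨ xor-comm-cancel (inN H v w) (eqb w v) ⟩
    eqb w v                                  ∎
  hχ : ∀ w → transvect v (inN H v) (λ w → eqb w v) w ≡ H' w v
  hχ w = begin
    eqb w v xor (eqb v v ∧ inN H v w)        ≡⟨ cong (λ b → eqb w v xor (b ∧ inN H v w)) (eqb-refl v) ⟩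
    eqb w v xor inN H v w                    ≡⟨ xor-comm (eqb w v) (inN H v w) ⟩
    inN H v w xor eqb w v                    ≡⟨ sym (column w) ⟩
    H w v                                    ≡⟨ sym (keep w) ⟩
    H' w v                                   ∎
... | false = cell-transvects {H = H} {H'} {v} {inN H v} {v} {φ↔ψ} hφ hχ
  where
  open ≡-Reasoning
  column : ∀ w → H w v ≡ inN H v w
  column w = trans (column-pivot sy v w) (cong (λ b → inN H v w xor (eqb w v ∧ b)) loop ⟨ trans ⟩
                                          trans (cong (inN H v w xor_) (∧-zeroʳ (eqb w v))) (xor-identityʳ _))
  hφ : ∀ w → transvect v (inN H v) (λ w → eqb w v xor H w v) w ≡ eqb w v
  hφ w = begin
    (eqb w v xor H w v) xor ((eqb v v xor H v v) ∧ inN H v w)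
      ≡⟨ cong₂ (λ p q → (eqb w v xor p) xor (q ∧ inN H v w)) (column w) (cong₂ _xor_ (eqb-refl v) loop) ⟩
    (eqb w v xor inN H v w) xor inN H v w
      ≡⟨ xor-cancelʳ (eqb w v) (inN H v w) ⟩
    eqb w v ∎
  hχ : ∀ w → transvect v (inN H v) (λ w → H w v) w ≡ H' w v
  hχ w = begin
    H w v xor (H v v ∧ inN H v w)   ≡⟨ cong (λ b → H w v xor (b ∧ inN H v w)) loop ⟩
    H w v xor false                 ≡⟨ xor-identityʳ (H w v) ⟩
    H w v                           ≡⟨ sym (keep w) ⟩
    H' w v                          ∎

transvect-zero : ∀ {m} (v : Fin m) x w → transvect v (λ _ → false) x w ≡ x w
transvect-zero v x w = trans (cong (x w xor_) (∧-zeroʳ (x v))) (xor-identityʳ (x w))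

loopCompl-swaps : ∀ {m} → Fin m → Fin m → LabelSwap
loopCompl-swaps v u = if eqb u v then χ↔ψ else noSwap

localComplNS-swaps : ∀ {m} → Graph m → Fin m → Fin m → LabelSwap
localComplNS-swaps H v u = if eqb u v then pivotSwap (H v v) else noSwap

localComplS-swaps : ∀ {m} → Graph m → Fin m → Fin m → LabelSwap
localComplS-swaps H v u = if eqb u v then pivotSwap (H v v) else (if inN H v u then χ↔ψ else noSwap)

loopCompl-transvects : ∀ {m} (H : Graph m) v →
  TransvectsTo H (loopCompl v H) v (λ _ → false) (loopCompl-swaps v)
loopCompl-transvects H v u with u ≟ v
... | yes refl = cell-transvects {s = χ↔ψ} (transvect-zero v _) λ w → begin
  transvect v (λ _ → false) (iasCol H (v , ψ)) w   ≡⟨ transvect-zero v (iasCol H (v , ψ)) w ⟩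
  eqb w v xor H w v                                ≡⟨ xor-comm (eqb w v) (H w v) ⟩
  H w v xor eqb w v
    ≡⟨ cong (H w v xor_) (sym (trans (cong (eqb w v ∧_) (eqb-refl v)) (∧-identityʳ _))) ⟩
  H w v xor (eqb w v ∧ eqb v v)                    ∎
  where open ≡-Reasoning
... | no u≢v = off-pivot-cell u≢v λ w → begin
  transvect v (λ _ → false) (iasCol H (u , χ)) w   ≡⟨ transvect-zero v (iasCol H (u , χ)) w ⟩
  H w u                                            ≡⟨ sym (xor-identityʳ _) ⟩
  H w u xor false                                  ≡⟨ cong (H w u xor_) (sym (∧-zeroʳ (eqb w v))) ⟩
  H w u xor (eqb w v ∧ false)
    ≡⟨ cong (λ b → H w u xor (eqb w v ∧ b)) (sym (eqb-false u≢v)) ⟩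
  H w u xor (eqb w v ∧ eqb u v)                    ∎
  where open ≡-Reasoning

localComplNS-transvects : ∀ {m} (H : Graph m) v → IsLoopedSimple H →
  TransvectsTo H (localComplNS v H) v (inN H v) (localComplNS-swaps H v)
localComplNS-transvects H v sy u with u ≟ v
... | yes refl = pivot-cell sy λ w →
  trans (cong (λ b → H w v xor (inN H v w ∧ b)) (inN-self H v))
        (trans (cong (H w v xor_) (∧-zeroʳ _)) (xor-identityʳ _))
... | no u≢v = off-pivot-cell u≢v λ w →
  cong (H w u xor_) (trans (∧-comm (H v u) (inN H v w)) (cong (inN H v w ∧_) (sym (inN-other H u≢v))))

localComplS-transvects : ∀ {m} (H : Graph m) v → IsLoopedSimple H →
  TransvectsTo H (localComplS v H) v (inN H v) (localComplS-swaps H v)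
localComplS-transvects H v sy u with u ≟ v
... | yes refl = pivot-cell sy λ w →
  trans (cong (λ b → H w v xor (inN H v w ∧ (b ∧ not (eqb w v)))) (inN-self H v))
        (trans (cong (H w v xor_) (∧-zeroʳ _)) (xor-identityʳ _))
... | no u≢v with H v u in adj
...   | false = off-pivot-cell u≢v λ w → begin
  H w u xor (H v u ∧ inN H v w)                         ≡⟨ cong (λ b → H w u xor (b ∧ inN H v w)) adj ⟩
  H w u xor false                                       ≡⟨ cong (H w u xor_) (sym (∧-zeroʳ (inN H v w))) ⟩
  H w u xor (inN H v w ∧ false)
    ≡⟨ cong (λ b → H w u xor (inN H v w ∧ (b ∧ not (eqb w u)))) (sym (trans (inN-other H u≢v) adj)) ⟩
  H w u xor (inN H v w ∧ (inN H v u ∧ not (eqb w u)))   ∎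
  where open ≡-Reasoning
...   | true = off-pivot-cell-χ↔ψ u≢v λ w → begin
  (eqb w u xor H w u) xor ((eqb v u xor H v u) ∧ inN H v w)
    ≡⟨ cong₂ (λ p q → (eqb w u xor H w u) xor ((p xor q) ∧ inN H v w))
             (eqb-false (u≢v ∘ sym)) adj ⟩
  (eqb w u xor H w u) xor inN H v w
    ≡⟨ add-unit-to-neighbour (eqb w u) (H w u) (inN H v w) (diag w) ⟩
  H w u xor (inN H v w ∧ not (eqb w u))
    ≡⟨ cong (λ b → H w u xor (inN H v w ∧ (b ∧ not (eqb w u)))) (sym (trans (inN-other H u≢v) adj)) ⟩
  H w u xor (inN H v w ∧ (inN H v u ∧ not (eqb w u)))   ∎
  where
  open ≡-Reasoning
  diag : ∀ w → eqb w u ∧ inN H v w ≡ eqb w u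
  diag w = trans (eqb-∧-diag (inN H v) w u)
                 (trans (cong (eqb w u ∧_) (trans (inN-other H u≢v) adj)) (∧-identityʳ _))
  add-unit-to-neighbour : ∀ e h t → e ∧ t ≡ e → (e xor h) xor t ≡ h xor (t ∧ not e)
  add-unit-to-neighbour false h t _ = cong (h xor_) (sym (∧-identityʳ t))
  add-unit-to-neighbour true false true _ = refl
  add-unit-to-neighbour true true true _ = refl

loopCompl-sym : ∀ {m} (H : Graph m) v → IsLoopedSimple H → IsLoopedSimple (loopCompl v H)
loopCompl-sym H v sy i j = cong₂ _xor_ (sy i j) (∧-comm (eqb i v) (eqb j v))

localComplNS-sym : ∀ {m} (H : Graph m) v → IsLoopedSimple H → IsLoopedSimple (localComplNS v H)
localComplNS-sym H v sy i j = cong₂ _xor_ (sy i j) (∧-comm (inN H v i) (inN H v j))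

localComplS-sym : ∀ {m} (H : Graph m) v → IsLoopedSimple H → IsLoopedSimple (localComplS v H)
localComplS-sym H v sy i j = cong₂ _xor_ (sy i j) (begin
  inN H v i ∧ (inN H v j ∧ not (eqb i j))   ≡⟨ ∧-exchange (inN H v i) (inN H v j) _ ⟩
  inN H v j ∧ (inN H v i ∧ not (eqb i j))   ≡⟨ cong (λ b → inN H v j ∧ (inN H v i ∧ not b)) (eqb-sym i j) ⟩
  inN H v j ∧ (inN H v i ∧ not (eqb j i))   ∎)
  where
  open ≡-Reasoning
  ∧-exchange : ∀ a b c → a ∧ (b ∧ c) ≡ b ∧ (a ∧ c)
  ∧-exchange = solve-∀ xor-∧-ring

deleteV-sym : ∀ {m} (H : Graph (suc m)) v → IsLoopedSimple H → IsLoopedSimple (deleteV v H)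
deleteV-sym H v sy i j = sy _ _

Reach-sym : ∀ {n m} {G : Graph n} {H : Graph m} → IsLoopedSimple G → Reach G m H → IsLoopedSimple H
Reach-sym sy start = sy
Reach-sym sy (lc-s r v) = localComplS-sym _ v (Reach-sym sy r)
Reach-sym sy (lc-ns r v) = localComplNS-sym _ v (Reach-sym sy r)
Reach-sym sy (loopc r v) = loopCompl-sym _ v (Reach-sym sy r)
Reach-sym sy (del r v) = deleteV-sym _ v (Reach-sym sy r)

-- Vertex deletion

module Deletion {m : ℕ} (H : Graph (suc m)) (v : Fin (suc m)) where

  private
    Hd : Graph m
    Hd = deleteV v H
    module CH = Columns (iasCol H)
    module CD = Columns (iasCol Hd)

  pv : Elt m → Elt (suc m)
  pv (i , t) = punchIn v i , t

  OffCell : Sub (Elt (suc m)) → Set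
  OffCell S = ∀ t → S (v , t) ≡ false

  Isolated : Set
  Isolated = ∀ w → w ≢ v → H v w ≡ false

  eqb-punchIn : ∀ i j → eqb (punchIn v i) (punchIn v j) ≡ eqb i j
  eqb-punchIn i j with i ≟ j
  ... | yes refl = eqb-refl (punchIn v i)
  ... | no i≢j = eqb-false (i≢j ∘ punchIn-injective v i j)

  iasCol-deleteV : ∀ e w → iasCol Hd e w ≡ iasCol H (pv e) (punchIn v w)
  iasCol-deleteV (i , φ) w = sym (eqb-punchIn w i)
  iasCol-deleteV (i , χ) w = refl
  iasCol-deleteV (i , ψ) w = cong (_xor H (punchIn v w) (punchIn v i)) (sym (eqb-punchIn w i))

  Fin-cases : (P : Fin (suc m) → Set) → P v → (∀ w → P (punchIn v w)) → ∀ u → P u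
  Fin-cases P pivot others u with v ≟ u
  ... | yes refl = pivot
  ... | no v≢u = subst P (punchIn-punchOut v≢u) (others (punchOut v≢u))

  Elt-cases : (P : Elt (suc m) → Set) → (∀ t → P (v , t)) → (∀ e → P (pv e)) → ∀ e → P e
  Elt-cases P pivot others (u , t) = Fin-cases (λ u → P (u , t)) (pivot t) (λ w → others (w , t)) u

  total-punchIn : ∀ U w →
    CH.total U (punchIn v w) ≡ cellSum (iasCol H) U v (punchIn v w) xor CD.total (U ∘ pv) w
  total-punchIn U w = begin
    CH.total U (punchIn v w)
      ≡⟨ sumCols-elts (iasCol H) U (punchIn v w) ⟩
    sum (λ u → cellSum (iasCol H) U u (punchIn v w))
      ≡⟨ sum-remove {i = v} (λ u → cellSum (iasCol H) U u (punchIn v w)) ⟩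
    cellSum (iasCol H) U v (punchIn v w) xor sum (λ i → cellSum (iasCol H) U (punchIn v i) (punchIn v w))
      ≡⟨ cong (cellSum (iasCol H) U v (punchIn v w) xor_) (sum-cong-≗ λ i →
           sumCols-cong-col (iasCol H ∘ pv) {col' = iasCol Hd} (cell i) (U ∘ pv) (punchIn v w) w
             λ e → sym (iasCol-deleteV e w)) ⟩
    cellSum (iasCol H) U v (punchIn v w) xor sum (λ i → cellSum (iasCol Hd) (U ∘ pv) i w)
      ≡⟨ cong (cellSum (iasCol H) U v (punchIn v w) xor_) (sym (sumCols-elts (iasCol Hd) (U ∘ pv) w)) ⟩
    cellSum (iasCol H) U v (punchIn v w) xor CD.total (U ∘ pv) w ∎
    where open ≡-Reasoning

  total-pivot-row : ∀ U →
    CH.total U v ≡ cellSum (iasCol H) U v v xor sum (λ i → cellSum (iasCol H) U (punchIn v i) v)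
  total-pivot-row U = trans (sumCols-elts (iasCol H) U v) (sum-remove {i = v} (λ u → cellSum (iasCol H) U u v))

  v∉⁅⁆ : ∀ e {t} → ⁅ v , t ⁆ (pv e) ≡ false
  v∉⁅⁆ (i , _) = ∉⁅⁆ (punchInᵢ≢i v i ∘ cong proj₁)

  lift : Sub (Elt m) → Sub (Elt (suc m))
  lift U (u , t) with v ≟ u
  ... | yes _ = false
  ... | no v≢u = U (punchOut v≢u , t)

  lift-pivot : ∀ U t → lift U (v , t) ≡ false
  lift-pivot U t with v ≟ v
  ... | yes _ = refl
  ... | no v≢v = ⊥-elim (v≢v refl)

  lift-punchIn : ∀ U e → lift U (pv e) ≡ U e
  lift-punchIn U (i , t) with v ≟ punchIn v i
  ... | yes v≡ = ⊥-elim (punchInᵢ≢i v i (sym v≡))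
  ... | no _ = cong (λ j → U (j , t)) (trans (punchOut-cong v refl) (punchOut-punchIn v))

  lift-⊆ : ∀ {U S} → U ⊆ (S ∘ pv) → lift U ⊆ S
  lift-⊆ {U} {S} U⊆ = Elt-cases (λ e → lift U e ≡ true → S e ≡ true)
    (λ t p → ⊥-elim (not-¬ (lift-pivot U t) p))
    (λ e p → U⊆ e (trans (sym (lift-punchIn U e)) p))

  total-lift-punchIn : ∀ U w → CH.total (lift U) (punchIn v w) ≡ CD.total U w
  total-lift-punchIn U w = begin
    CH.total (lift U) (punchIn v w)
      ≡⟨ total-punchIn (lift U) w ⟩
    cellSum (iasCol H) (lift U) v (punchIn v w) xor CD.total (lift U ∘ pv) w
      ≡⟨ cong₂ _xor_ (cellSum-empty (iasCol H) (lift U) v (punchIn v w) (lift-pivot U))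
                     (CD.total-cong (lift-punchIn U) w) ⟩
    CD.total U w ∎
    where open ≡-Reasoning

  private
    offPivot-vanish : ∀ {S U} → CD.Independent (S ∘ pv) → (U ∘ pv) ⊆ (S ∘ pv) →
      U (v , χ) ≡ false → U (v , ψ) ≡ false → CH.SumsToZero U → ∀ e → U (pv e) ≡ false
    offPivot-vanish {U = U} indS U⊆ Uχ Uψ null = indS (U ∘ pv) U⊆ λ w → begin
      CD.total (U ∘ pv) w
        ≡⟨ cong (_xor CD.total (U ∘ pv) w) (sym (pivot-cell-off-row w)) ⟩
      cellSum (iasCol H) U v (punchIn v w) xor CD.total (U ∘ pv) w
        ≡⟨ sym (total-punchIn U w) ⟩
      CH.total U (punchIn v w)
        ≡⟨ null (punchIn v w) ⟩
      false ∎
      where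
      open ≡-Reasoning
      pivot-cell-off-row : ∀ w → cellSum (iasCol H) U v (punchIn v w) ≡ false
      pivot-cell-off-row w rewrite Uχ | Uψ | eqb-false (punchInᵢ≢i v w) =
        trans (xor-identityʳ _) (∧-zeroʳ (U (v , φ)))

  -- M(IAS(deleteV v H)) is M(IAS(H)) with v_φ, the unit vector of v, contracted and
  -- v_χ, v_ψ deleted; when v is isolated the whole cell of v may be deleted instead.
  Independent-deleteV : ∀ {S} → OffCell S → CD.Independent (S ∘ pv) → CH.Independent S
  Independent-deleteV {S} S∌ indS U U⊆S null = Elt-cases (λ e → U e ≡ false) off-cell
    (offPivot-vanish {S} {U} indS (U⊆S ∘ pv) (off-cell χ) (off-cell ψ) null)
    where
    off-cell : ∀ t → U (v , t) ≡ false
    off-cell t = ¬-not λ Ut → not-¬ (S∌ t) (U⊆S _ Ut)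

  Independent-deleteV-isolated : ∀ {S} → Isolated → CH.Independent S → CD.Independent (S ∘ pv)
  Independent-deleteV-isolated {S} isolated indS U U⊆ null e =
    trans (sym (lift-punchIn U e)) (indS (lift U) (lift-⊆ U⊆) lift-null (pv e))
    where
    lift-null : CH.SumsToZero (lift U)
    lift-null = Fin-cases (λ r → CH.total (lift U) r ≡ false)
      (begin
        CH.total (lift U) v
          ≡⟨ total-pivot-row (lift U) ⟩
        cellSum (iasCol H) (lift U) v v xor sum (λ i → cellSum (iasCol H) (lift U) (punchIn v i) v)
          ≡⟨ cong₂ _xor_ (cellSum-empty (iasCol H) (lift U) v v (lift-pivot U))
                         (trans (sum-cong-≗ λ i → cellSum-null-row (iasCol H) (lift U) (punchIn v i) v (zero-entry i))
                                (sum-replicate-zero m)) ⟩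
        false ∎)
      (λ w → trans (total-lift-punchIn U w) (null w))
      where
      open ≡-Reasoning
      no-edge : ∀ i → H v (punchIn v i) ≡ false
      no-edge i = isolated (punchIn v i) (punchInᵢ≢i v i)
      zero-entry : ∀ i t → iasCol H (punchIn v i , t) v ≡ false
      zero-entry i φ = eqb-false (punchInᵢ≢i v i ∘ sym)
      zero-entry i χ = no-edge i
      zero-entry i ψ = cong₂ _xor_ (eqb-false (punchInᵢ≢i v i ∘ sym)) (no-edge i)

  Independent-deleteV-contract : ∀ {S} → OffCell S → CD.Independent (S ∘ pv) →
    CH.Independent (S ∪ ⁅ v , φ ⁆)
  Independent-deleteV-contract {S} S∌ indS U U⊆ null = Elt-cases (λ e → U e ≡ false) on-cell off-cell
    where
    not-φ : ∀ t → t ≢ φ → U (v , t) ≡ false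
    not-φ t t≢φ = ¬-not λ Ut →
      not-¬ (S∌ t) (∪-left S ⁅ v , φ ⁆ _ (U⊆ _ Ut) (∉⁅⁆ (t≢φ ∘ cong proj₂)))
    off-cell : ∀ e → U (pv e) ≡ false
    off-cell = offPivot-vanish {S} {U} indS
      (λ e p → ∪-left S ⁅ v , φ ⁆ (pv e) (U⊆ (pv e) p) (v∉⁅⁆ e))
      (not-φ χ λ ()) (not-φ ψ λ ()) null
    on-cell : ∀ t → U (v , t) ≡ false
    on-cell φ = trans (sym pivot-row) (null v)
      where
      open ≡-Reasoning
      pivot-entry : cellSum (iasCol H) U v v ≡ U (v , φ)
      pivot-entry rewrite not-φ χ (λ ()) | not-φ ψ (λ ()) | eqb-refl v = trans (xor-identityʳ _) (∧-identityʳ _)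
      pivot-row : CH.total U v ≡ U (v , φ)
      pivot-row = begin
        CH.total U v
          ≡⟨ total-pivot-row U ⟩
        cellSum (iasCol H) U v v xor sum (λ i → cellSum (iasCol H) U (punchIn v i) v)
          ≡⟨ cong₂ _xor_ pivot-entry (trans (sum-cong-≗ λ i → cellSum-empty (iasCol H) U (punchIn v i) v
                                                                   λ t → off-cell (i , t))
                                            (sum-replicate-zero m)) ⟩
        U (v , φ) xor false
          ≡⟨ xor-identityʳ _ ⟩
        U (v , φ) ∎
    on-cell χ = not-φ χ λ ()
    on-cell ψ = not-φ ψ λ ()

  Independent-deleteV-uncontract : ∀ {S} → CH.Independent (S ∪ ⁅ v , φ ⁆) → CD.Independent (S ∘ pv)
  Independent-deleteV-uncontract {S} ind U U⊆ null e =
    trans (sym (Û-punchIn e)) (ind Û Û⊆ Û-null (pv e))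
    where
    open ≡-Reasoning
    b : Bool
    b = CH.total (lift U) v
    -- lift U is null on every row but v; adding b·v_φ cancels row v.
    Û : Sub (Elt (suc m))
    Û = lift U △ (λ e → b ∧ ⁅ v , φ ⁆ e)
    Û⊆ : Û ⊆ (S ∪ ⁅ v , φ ⁆)
    Û⊆ = △-⊆ (⊆-trans (lift-⊆ U⊆) (⊆-∪ˡ S ⁅ v , φ ⁆))
             (λ e p → ⊆-∪ʳ S ⁅ v , φ ⁆ e (∧-conicalʳ _ _ p))
    total-Û : ∀ r → CH.total Û r ≡ CH.total (lift U) r xor (b ∧ eqb r v)
    total-Û r = trans (CH.total-△ (lift U) _ r) (cong (CH.total (lift U) r xor_) (CH.total-⁅⁆-scaled b (v , φ) r))
    Û-null : CH.SumsToZero Û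
    Û-null = Fin-cases (λ r → CH.total Û r ≡ false)
      (begin
        CH.total Û v                  ≡⟨ total-Û v ⟩
        b xor (b ∧ eqb v v)           ≡⟨ cong (λ p → b xor (b ∧ p)) (eqb-refl v) ⟩
        b xor (b ∧ true)              ≡⟨ cong (b xor_) (∧-identityʳ b) ⟩
        b xor b                       ≡⟨ xor-same b ⟩
        false                         ∎)
      (λ w → begin
        CH.total Û (punchIn v w)                           ≡⟨ total-Û (punchIn v w) ⟩
        CH.total (lift U) (punchIn v w) xor (b ∧ eqb (punchIn v w) v)
          ≡⟨ cong₂ (λ p q → p xor (b ∧ q)) (trans (total-lift-punchIn U w) (null w))
                                            (eqb-false (punchInᵢ≢i v w)) ⟩
        b ∧ false                                          ≡⟨ ∧-zeroʳ b ⟩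
        false                                              ∎)
    Û-punchIn : ∀ e → Û (pv e) ≡ U e
    Û-punchIn e = begin
      lift U (pv e) xor (b ∧ ⁅ v , φ ⁆ (pv e))
        ≡⟨ cong₂ (λ p q → p xor (b ∧ q)) (lift-punchIn U e) (v∉⁅⁆ e) ⟩
      U e xor (b ∧ false)  ≡⟨ cong (U e xor_) (∧-zeroʳ b) ⟩
      U e xor false        ≡⟨ xor-identityʳ (U e) ⟩
      U e                  ∎

-- Minor models

module IAS {n : ℕ} (G : Graph n) = Columns (iasCol G)

embed : ∀ {n m} → (Fin m → Fin n) → (Fin m → Lbl → Lbl) → Elt m → Elt n
embed ι σ (i , t) = ι i , σ i t

remaining-disjoint : ∀ {n} {R : Sub (Fin n)} {c T} → T ⊆ remaining R → Disjoint T (contracted R c)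
remaining-disjoint {R = R} T⊆ (u , t) Tut with R u | T⊆ (u , t) Tut
... | false | _ = refl

-- h = embed ι σ maps M(IAS(H)) isomorphically onto the minor of M(IAS(G)) that removes the
-- cells of R, the cell of u by contracting its element labelled c u; σ i relabels the cell of i.
record MinorModel {n : ℕ} (G : Graph n) {m : ℕ} (H : Graph m) (R : Sub (Fin n)) (c : Fin n → Lbl) : Set where
  field
    ι : Fin m → Fin n
    σ σ⁻¹ : Fin m → Lbl → Lbl
    σ-σ⁻¹ : ∀ i t → σ i (σ⁻¹ i t) ≡ t
    σ⁻¹-σ : ∀ i t → σ⁻¹ i (σ i t) ≡ t
    ι-injective : ∀ i j → ι i ≡ ι j → i ≡ j
    ι-kept : ∀ i → R (ι i) ≡ false
    ι-onto : ∀ u → R u ≡ false → ∃ λ i → ι i ≡ u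
    modulo⇒indep : ∀ T → T ⊆ remaining R → IAS.IndepModulo G (contracted R c) T → IASIndep H (T ∘ embed ι σ)
    indep⇒modulo : ∀ T → T ⊆ remaining R → IASIndep H (T ∘ embed ι σ) → IAS.IndepModulo G (contracted R c) T

  h : Elt m → Elt n
  h = embed ι σ

  h-injective : ∀ e e' → h e ≡ h e' → e ≡ e'
  h-injective (i , t) (j , t') he≡he' with ι-injective i j (cong proj₁ he≡he')
  ... | refl = cong (i ,_) (trans (sym (σ⁻¹-σ i t)) (trans (cong (σ⁻¹ i ∘ proj₂) he≡he') (σ⁻¹-σ i t')))

  h-remaining : ∀ e → remaining R (h e) ≡ true
  h-remaining (i , t) = cong not (ι-kept i)

  h-onto : ∀ e → remaining R e ≡ true → ∃ λ e' → h e' ≡ e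
  h-onto (u , t) Ru≡f with ι-onto u (trans (sym (not-involutive (R u))) (cong not Ru≡f))
  ... | i , ιi≡u = (i , σ⁻¹ i t) , cong₂ _,_ ιi≡u (σ-σ⁻¹ i t)

  -- The subset T ∘ h⁻¹ of the remaining elements.
  pullback : Sub (Elt m) → Sub (Elt n)
  pullback T (u , t) = pick (any? λ j → ι j ≟ u)
    where
    pick : Dec (∃ λ j → ι j ≡ u) → Bool
    pick (yes (j , _)) = T (j , σ⁻¹ j t)
    pick (no _) = false

  pullback-h : ∀ T e → pullback T (h e) ≡ T e
  pullback-h T (i , t) with any? (λ j → ι j ≟ ι i)
  ... | yes (j , ιj≡ιi) with ι-injective j i ιj≡ιi
  ...   | refl = cong (λ t' → T (j , t')) (σ⁻¹-σ j t)
  pullback-h T (i , t) | no ∄j = ⊥-elim (∄j (i , refl))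

  pullback-remaining : ∀ T → pullback T ⊆ remaining R
  pullback-remaining T (u , t) p with any? (λ j → ι j ≟ u)
  ... | yes (j , refl) = cong not (ι-kept j)

  ⁅⁆-h : ∀ e e' → ⁅ h e ⁆ (h e') ≡ ⁅ e ⁆ e'
  ⁅⁆-h e e' with e' ≟ᴱ e
  ... | yes refl = ∈⁅⁆ (h e)
  ... | no e'≢e = ∉⁅⁆ (e'≢e ∘ h-injective e' e)

open MinorModel

MinorModel-start : ∀ {n} (G : Graph n) → MinorModel G G (λ _ → false) (λ _ → φ)
MinorModel-start G = record
  { ι = id ; σ = λ _ t → t ; σ⁻¹ = λ _ t → t ; σ-σ⁻¹ = λ _ _ → refl ; σ⁻¹-σ = λ _ _ → refl
  ; ι-injective = λ _ _ → id ; ι-kept = λ _ → refl ; ι-onto = λ u _ → u , refl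
  ; modulo⇒indep = λ T _ → IAS.IndepModulo∅⇒Independent G
  ; indep⇒modulo = λ T _ → IAS.Independent⇒IndepModulo∅ G }

MinorModel-cong : ∀ {n m} {G : Graph n} {H : Graph m} {R R' c c'} → MinorModel G H R c →
  R ≐ R' → (∀ u → R u ≡ true → c u ≡ c' u) → MinorModel G H R' c'
MinorModel-cong {G = G} {R = R} {R'} {c} {c'} M R≐R' c≡c' = record
  { ι = ι M ; σ = σ M ; σ⁻¹ = σ⁻¹ M ; σ-σ⁻¹ = σ-σ⁻¹ M ; σ⁻¹-σ = σ⁻¹-σ M
  ; ι-injective = ι-injective M
  ; ι-kept = λ i → trans (sym (R≐R' (ι M i))) (ι-kept M i)
  ; ι-onto = λ u R'u → ι-onto M u (trans (R≐R' u) R'u)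
  ; modulo⇒indep = λ T T⊆ mod →
      modulo⇒indep M T (⊆R T⊆) (IAS.IndepModulo-mono G (⊆-≐ contracted≐) mod)
  ; indep⇒modulo = λ T T⊆ ind →
      IAS.IndepModulo-mono G (⊆-≐ (sym ∘ contracted≐)) (indep⇒modulo M T (⊆R T⊆) ind) }
  where
  ⊆R : ∀ {T} → T ⊆ remaining R' → T ⊆ remaining R
  ⊆R T⊆ (u , t) Tut = trans (cong not (R≐R' u)) (T⊆ (u , t) Tut)
  contracted≐ : contracted R c ≐ contracted R' c'
  contracted≐ (u , t) with R u in Ru
  ... | true rewrite sym (R≐R' u) | Ru | c≡c' u Ru = refl
  ... | false rewrite sym (R≐R' u) | Ru = refl

MinorModel-transvect : ∀ {n m} {G : Graph n} {H H' : Graph m} {R c v a τ} → MinorModel G H R c →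
  TransvectsTo H H' v a τ → a v ≡ false → MinorModel G H' R c
MinorModel-transvect {τ = τ} M H→H' av≡f = record
  { ι = ι M ; σ = λ j t → σ M j (swap (τ j) t) ; σ⁻¹ = λ j t → swap (τ j) (σ⁻¹ M j t)
  ; σ-σ⁻¹ = λ j t → trans (cong (σ M j) (swap-involutive (τ j) _)) (σ-σ⁻¹ M j t)
  ; σ⁻¹-σ = λ j t → trans (cong (swap (τ j)) (σ⁻¹-σ M j _)) (swap-involutive (τ j) t)
  ; ι-injective = ι-injective M ; ι-kept = ι-kept M ; ι-onto = ι-onto M
  ; modulo⇒indep = λ T T⊆ mod →
      Transvected.Independent-transvect H→H' av≡f (T ∘ h M) (modulo⇒indep M T T⊆ mod)
  ; indep⇒modulo = λ T T⊆ ind →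
      indep⇒modulo M T T⊆ (Transvected.Independent-untransvect H→H' av≡f (T ∘ h M) ind) }

module DeleteStep {n m : ℕ} {G : Graph n} {H : Graph (suc m)} {R : Sub (Fin n)} {c : Fin n → Lbl}
  (M : MinorModel G H R c) (i : Fin (suc m)) (t : Lbl) where

  open Deletion H i

  x : Elt n
  x = h M (i , t)

  R' : Sub (Fin n)
  R' u = R u ∨ eqb u (ι M i)

  c' : Fin n → Lbl
  c' u = if eqb u (ι M i) then σ M i t else c u

  private
    C : Sub (Elt n)
    C = contracted R c

  contracted-R' : contracted R' c' ≐ (C ∪ ⁅ x ⁆)
  contracted-R' (u , t') with eqb u (ι M i) in u≟ι
  ... | true with eqb-true u≟ι
  ...   | refl rewrite ι-kept M i = sym (⁅⁆-same-vertex (ι M i) (σ M i t) t')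
  contracted-R' (u , t') | false
    rewrite ∨-identityʳ (R u) | ∉⁅⁆ {x = x} {u , t'} (eqb-false⁻¹ u≟ι ∘ cong proj₁) =
      sym (if-true-false _)

  remaining-R' : ∀ {T} → T ⊆ remaining R' → T ⊆ remaining R
  remaining-R' T⊆ (u , t') Tut' with R u | T⊆ (u , t') Tut'
  ... | false | _ = refl

  x-remaining : ⁅ x ⁆ ⊆ remaining R
  x-remaining = ⁅⁆-⊆ (h-remaining M (i , t))

  off-cell : ∀ {T} → T ⊆ remaining R' → OffCell (T ∘ h M)
  off-cell {T} T⊆ t' = ¬-not λ Tx → not-¬ removed (T⊆ _ Tx)
    where
    removed : not (R (ι M i) ∨ eqb (ι M i) (ι M i)) ≡ false
    removed rewrite ι-kept M i | eqb-refl (ι M i) = refl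

  ⁅x⁆∘h : (⁅ x ⁆ ∘ h M) ≐ ⁅ i , t ⁆
  ⁅x⁆∘h = ⁅⁆-h M (i , t)

  RemovesCell : Set
  RemovesCell = ∀ T → T ⊆ remaining R' →
    (IAS.IndepModulo G (C ∪ ⁅ x ⁆) T → IASIndep (deleteV i H) (T ∘ h M ∘ pv))
    × (IASIndep (deleteV i H) (T ∘ h M ∘ pv) → IAS.IndepModulo G (C ∪ ⁅ x ⁆) T)

  model : RemovesCell → MinorModel G (deleteV i H) R' c'
  model removal = record
    { ι = ι M ∘ punchIn i ; σ = σ M ∘ punchIn i ; σ⁻¹ = σ⁻¹ M ∘ punchIn i
    ; σ-σ⁻¹ = σ-σ⁻¹ M ∘ punchIn i ; σ⁻¹-σ = σ⁻¹-σ M ∘ punchIn i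
    ; ι-injective = λ j k p → punchIn-injective i j k (ι-injective M _ _ p)
    ; ι-kept = λ j → cong₂ _∨_ (ι-kept M (punchIn i j)) (eqb-false (punchInᵢ≢i i j ∘ ι-injective M _ _))
    ; ι-onto = onto
    ; modulo⇒indep = λ T T⊆ mod →
        proj₁ (removal T T⊆) (IAS.IndepModulo-mono G (⊆-≐ (sym ∘ contracted-R')) mod)
    ; indep⇒modulo = λ T T⊆ ind → IAS.IndepModulo-mono G (⊆-≐ contracted-R') (proj₂ (removal T T⊆) ind) }
    where
    onto : ∀ u → R' u ≡ false → ∃ λ j → ι M (punchIn i j) ≡ u
    onto u R'u≡f with ι-onto M u (∨-conicalˡ _ _ R'u≡f)
    ... | j , ιj≡u = punchOut i≢j , trans (cong (ι M) (punchIn-punchOut i≢j)) ιj≡u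
      where
      i≢j : i ≢ j
      i≢j i≡j = eqb-false⁻¹ (∨-conicalʳ _ _ R'u≡f) (trans (sym ιj≡u) (cong (ι M) (sym i≡j)))

  private
    T∪x-remaining : ∀ {T} → T ⊆ remaining R' → (T ∪ ⁅ x ⁆) ⊆ remaining R
    T∪x-remaining T⊆ = ∪-⊆ (remaining-R' T⊆) x-remaining

    ∪x∘h : ∀ T → ((T ∪ ⁅ x ⁆) ∘ h M) ≐ ((T ∘ h M) ∪ ⁅ i , t ⁆)
    ∪x∘h T e = cong (if T (h M e) then true else_) (⁅x⁆∘h e)

  -- Contracting x = h(i, φ), whose column in M(IAS(H)) is the unit vector of i.
  regular : t ≡ φ → RemovesCell
  regular refl T T⊆ = to , from
    where
    x-indep : IAS.IndepModulo G C ⁅ x ⁆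
    x-indep = indep⇒modulo M ⁅ x ⁆ x-remaining
      (IAS.Independent-⊆ H (⊆-≐ ⁅x⁆∘h) (IAS.Independent-⁅⁆ H (i , φ) i (eqb-refl i)))
    to : IAS.IndepModulo G (C ∪ ⁅ x ⁆) T → IASIndep (deleteV i H) (T ∘ h M ∘ pv)
    to mod = Independent-deleteV-uncontract
      (IAS.Independent-⊆ H (⊆-≐ (sym ∘ ∪x∘h T))
        (modulo⇒indep M (T ∪ ⁅ x ⁆) (T∪x-remaining T⊆) (IAS.IndepModulo-contract G x-indep mod)))
    from : IASIndep (deleteV i H) (T ∘ h M ∘ pv) → IAS.IndepModulo G (C ∪ ⁅ x ⁆) T
    from ind = IAS.IndepModulo-uncontract G
      (indep⇒modulo M (T ∪ ⁅ x ⁆) (T∪x-remaining T⊆)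
        (IAS.Independent-⊆ H (⊆-≐ (∪x∘h T)) (Independent-deleteV-contract (off-cell T⊆) ind)))

  -- Contracting x, a loop of M(IAS(H)) when i is isolated, amounts to deleting it.
  isolated : Isolated → (∀ w → iasCol H (i , t) w ≡ false) → RemovesCell
  isolated i-isolated null-column T T⊆ = to , from
    where
    T∩C : Disjoint T C
    T∩C = remaining-disjoint (remaining-R' T⊆)
    x-spanned : IAS.InSpan G C (iasCol G x)
    x-spanned with IAS.span? G C (iasCol G x)
    ... | yes x∈span = x∈span
    ... | no x∉span = ⊥-elim (IAS.null-column-dependent H (i , t) null-column
      (IAS.Independent-⊆ H (⊆-≐ (sym ∘ ⁅x⁆∘h))
        (modulo⇒indep M ⁅ x ⁆ x-remaining (IAS.unspanned⇒IndepModulo G x∉span))))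
    C-spans : IAS.Spans G C (C ∪ ⁅ x ⁆)
    C-spans e p with ∪-elim C ⁅ x ⁆ e p
    ... | inj₁ Ce = IAS.span-⁅⁆ G e Ce
    ... | inj₂ e∈x rewrite ∈⁅⁆⇒≡ e∈x = x-spanned
    to : IAS.IndepModulo G (C ∪ ⁅ x ⁆) T → IASIndep (deleteV i H) (T ∘ h M ∘ pv)
    to mod = Independent-deleteV-isolated i-isolated
      (modulo⇒indep M T (remaining-R' T⊆) (IAS.IndepModulo-mono G (⊆-∪ˡ C ⁅ x ⁆) mod))
    from : IASIndep (deleteV i H) (T ∘ h M ∘ pv) → IAS.IndepModulo G (C ∪ ⁅ x ⁆) T
    from ind = IAS.IndepModulo-span G T∩C
      (Disjoint-⊆ (remaining-disjoint {c = c'} T⊆) (⊆-≐ (sym ∘ contracted-R'))) C-spans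
      (indep⇒modulo M T (remaining-R' T⊆) (Independent-deleteV (off-cell T⊆) ind))

MinorModel-localComplS : ∀ {n m} {G : Graph n} {H : Graph m} {R c} → IsLoopedSimple H →
  MinorModel G H R c → (v : Fin m) → MinorModel G (localComplS v H) R c
MinorModel-localComplS {H = H} sy M v =
  MinorModel-transvect {τ = localComplS-swaps H v} M (localComplS-transvects H v sy) (inN-self H v)

MinorModel-localComplNS : ∀ {n m} {G : Graph n} {H : Graph m} {R c} → IsLoopedSimple H →
  MinorModel G H R c → (v : Fin m) → MinorModel G (localComplNS v H) R c
MinorModel-localComplNS {H = H} sy M v =
  MinorModel-transvect {τ = localComplNS-swaps H v} M (localComplNS-transvects H v sy) (inN-self H v)

MinorModel-loopCompl : ∀ {n m} {G : Graph n} {H : Graph m} {R c} →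
  MinorModel G H R c → (v : Fin m) → MinorModel G (loopCompl v H) R c
MinorModel-loopCompl {H = H} M v =
  MinorModel-transvect {a = λ _ → false} {τ = loopCompl-swaps v} M (loopCompl-transvects H v) refl

Reach⇒MinorModel : ∀ {n m} {G : Graph n} {H : Graph m} → IsLoopedSimple G → Reach G m H →
  Σ (Sub (Fin n)) λ R → Σ (Fin n → Lbl) λ c → MinorModel G H R c
Reach⇒MinorModel {G = G} sy start = _ , _ , MinorModel-start G
Reach⇒MinorModel sy (lc-s r v) with Reach⇒MinorModel sy r
... | R , c , M = R , c , MinorModel-localComplS (Reach-sym sy r) M v
Reach⇒MinorModel sy (lc-ns r v) with Reach⇒MinorModel sy r
... | R , c , M = R , c , MinorModel-localComplNS (Reach-sym sy r) M v
Reach⇒MinorModel sy (loopc r v) with Reach⇒MinorModel sy r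
... | R , c , M = R , c , MinorModel-loopCompl M v
Reach⇒MinorModel sy (del r v) with Reach⇒MinorModel sy r
... | R , c , M = _ , _ , DeleteStep.model M v φ (DeleteStep.regular M v φ refl)

-- Routing a cell into removable position, and removing all cells of R

localComplNS-swaps-pivot : ∀ {m} (H : Graph m) v → localComplNS-swaps H v v ≡ pivotSwap (H v v)
localComplNS-swaps-pivot H v rewrite eqb-refl v = refl

localComplS-swaps-neighbour : ∀ {m} (H : Graph m) {w i} → inN H w i ≡ true → localComplS-swaps H w i ≡ χ↔ψ
localComplS-swaps-neighbour H {w} {i} adj with i ≟ w
... | yes refl = ⊥-elim (not-¬ (∧-zeroʳ (H w w)) adj)
... | no _ rewrite adj = refl

localComplS-loops : ∀ {m} (H : Graph m) w i → localComplS w H i i ≡ H i i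
localComplS-loops H w i rewrite eqb-refl i | ∧-zeroʳ (inN H w i) | ∧-zeroʳ (inN H w i) = xor-identityʳ (H i i)

isolated-if-no-neighbour : ∀ {m} (H : Graph (suc m)) i → IsLoopedSimple H → (∀ w → inN H w i ≡ false) →
  Deletion.Isolated H i
isolated-if-no-neighbour H i sy no-nbr w w≢i = begin
  H i w                       ≡⟨ sy i w ⟩
  H w i                       ≡⟨ sym (∧-identityʳ (H w i)) ⟩
  H w i ∧ true                ≡⟨ cong (λ b → H w i ∧ not b) (sym (eqb-false (w≢i ∘ sym))) ⟩
  inN H w i                   ≡⟨ no-nbr w ⟩
  false                       ∎
  where open ≡-Reasoning

module _ {n : ℕ} {G : Graph n} {R : Sub (Fin n)} {c : Fin n → Lbl} where

  -- After local complementations at i or at a neighbour of i, the element σ i t of the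
  -- cell of i is either its φ-element or a loop at the then isolated vertex i.
  record Routed {m : ℕ} (H : Graph (suc m)) (M : MinorModel G H R c) (i : Fin (suc m)) (t : Lbl) : Set where
    field
      H' : Graph (suc m)
      extend : Reach G (suc m) H → Reach G (suc m) H'
      looped-simple : IsLoopedSimple H'
      M' : MinorModel G H' R c
      same-vertex : ι M' i ≡ ι M i
      t' : Lbl
      same-element : σ M' i t' ≡ σ M i t
      removes : DeleteStep.RemovesCell M' i t'

  module _ {m : ℕ} {H : Graph (suc m)} (sy : IsLoopedSimple H) (M : MinorModel G H R c) (i : Fin (suc m)) where

    route-φ : Routed H M i φ
    route-φ = record { H' = H ; extend = λ r → r ; looped-simple = sy ; M' = M ; same-vertex = refl
                     ; t' = φ ; same-element = refl ; removes = DeleteStep.regular M i φ refl }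

    route-NS : ∀ {t} → swap (pivotSwap (H i i)) φ ≡ t → Routed H M i t
    route-NS eq = record
      { H' = localComplNS i H ; extend = λ r → lc-ns r i ; looped-simple = localComplNS-sym H i sy
      ; M' = M' ; same-vertex = refl ; t' = φ
      ; same-element = cong (σ M i) (trans (cong (λ s → swap s φ) (localComplNS-swaps-pivot H i)) eq)
      ; removes = DeleteStep.regular M' i φ refl }
      where
      M' : MinorModel G (localComplNS i H) R c
      M' = MinorModel-localComplNS sy M i

    route-S-NS : ∀ {w t} → inN H w i ≡ true → swap χ↔ψ (swap (pivotSwap (H i i)) φ) ≡ t → Routed H M i t
    route-S-NS {w} adj eq = record
      { H' = localComplNS i H₁ ; extend = λ r → lc-ns (lc-s r w) i
      ; looped-simple = localComplNS-sym H₁ i sy₁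
      ; M' = M' ; same-vertex = refl ; t' = φ
      ; same-element = cong (σ M i) (begin
          swap (localComplS-swaps H w i) (swap (localComplNS-swaps H₁ i i) φ)
            ≡⟨ cong₂ (λ s s' → swap s (swap s' φ)) (localComplS-swaps-neighbour H adj)
                     (trans (localComplNS-swaps-pivot H₁ i) (cong pivotSwap (localComplS-loops H w i))) ⟩
          swap χ↔ψ (swap (pivotSwap (H i i)) φ)
            ≡⟨ eq ⟩
          _ ∎)
      ; removes = DeleteStep.regular M' i φ refl }
      where
      open ≡-Reasoning
      H₁ : Graph (suc m)
      H₁ = localComplS w H
      sy₁ : IsLoopedSimple H₁
      sy₁ = localComplS-sym H w sy
      M' : MinorModel G (localComplNS i H₁) R c
      M' = MinorModel-localComplNS sy₁ (MinorModel-localComplS sy M w) i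

    route-isolated : ∀ {t} → (∀ w → inN H w i ≡ false) → (∀ w → iasCol H (i , t) w ≡ false) →
      Routed H M i t
    route-isolated {t} no-nbr null-column = record
      { H' = H ; extend = λ r → r ; looped-simple = sy ; M' = M ; same-vertex = refl ; t' = t ; same-element = refl
      ; removes = DeleteStep.isolated M i t (isolated-if-no-neighbour H i sy no-nbr) null-column }

    route : ∀ t → Routed H M i t
    route φ = route-φ
    route χ with H i i in loop
    ... | true = route-NS (cong (λ b → swap (pivotSwap b) φ) loop)
    ... | false with any? (λ w → inN H w i ≟ᴮ true)
    ...   | yes (w , adj) = route-S-NS adj (cong (λ b → swap χ↔ψ (swap (pivotSwap b) φ)) loop)
    ...   | no no-adj = route-isolated no-nbr null-χ
      where
      no-nbr : ∀ w → inN H w i ≡ false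
      no-nbr w = ¬-not (no-adj ∘ (w ,_))
      null-χ : ∀ w → H w i ≡ false
      null-χ w with w ≟ i
      ... | yes refl = loop
      ... | no w≢i = trans (sy w i) (isolated-if-no-neighbour H i sy no-nbr w w≢i)
    route ψ with H i i in loop
    ... | false = route-NS (cong (λ b → swap (pivotSwap b) φ) loop)
    ... | true with any? (λ w → inN H w i ≟ᴮ true)
    ...   | yes (w , adj) = route-S-NS adj (cong (λ b → swap χ↔ψ (swap (pivotSwap b) φ)) loop)
    ...   | no no-adj = route-isolated no-nbr null-ψ
      where
      no-nbr : ∀ w → inN H w i ≡ false
      no-nbr w = ¬-not (no-adj ∘ (w ,_))
      null-ψ : ∀ w → eqb w i xor H w i ≡ false
      null-ψ w with w ≟ i
      ... | yes refl = cong not loop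
      ... | no w≢i = trans (sy w i) (isolated-if-no-neighbour H i sy no-nbr w w≢i)

any-eqb-∈ : ∀ {n} {u : Fin n} {l} → u ∈ l → any (eqb u) l ≡ true
any-eqb-∈ {u = u} (here refl) rewrite eqb-refl u = refl
any-eqb-∈ {u = u} {x ∷ _} (there u∈l) = trans (cong (eqb u x ∨_) (any-eqb-∈ u∈l)) (∨-zeroʳ (eqb u x))

module RemoveCells {n : ℕ} (G : Graph n) (syG : IsLoopedSimple G) (R : Sub (Fin n)) (c : Fin n → Lbl) where

  removedAmong : List (Fin n) → Sub (Fin n)
  removedAmong l u = R u ∧ any (eqb u) l

  Stage : List (Fin n) → Set
  Stage l = Σ ℕ λ m → Σ (Graph m) λ H → Reach G m H × IsLoopedSimple H × MinorModel G H (removedAmong l) c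

  removedAmong-∷ : ∀ l u → removedAmong l u ≡ R u → removedAmong l ≐ removedAmong (u ∷ l)
  removedAmong-∷ l u done u' with u' ≟ u
  ... | yes refl = trans done (sym (∧-identityʳ (R u)))
  ... | no _ = refl

  removedAmong-∷-new : ∀ l u → R u ≡ true → ∀ x → x ≡ u →
    (λ u' → removedAmong l u' ∨ eqb u' x) ≐ removedAmong (u ∷ l)
  removedAmong-∷-new l u Ru _ refl u' with u' ≟ u
  ... | yes refl = trans (∨-zeroʳ _) (sym (trans (∧-identityʳ (R u)) Ru))
  ... | no _ = ∨-identityʳ _

  remove : ∀ {l u m} {H : Graph m} → Reach G m H → IsLoopedSimple H → (M : MinorModel G H (removedAmong l) c) →
    R u ≡ true → (i : Fin m) → ι M i ≡ u → Stage (u ∷ l)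
  remove {l} {u} {suc m} {H} r sy M Ru i ιi≡u =
    m , deleteV i (Routed.H' rt) , del (Routed.extend rt r) i , deleteV-sym _ i (Routed.looped-simple rt) ,
    MinorModel-cong (DeleteStep.model (Routed.M' rt) i (Routed.t' rt) (Routed.removes rt))
      (removedAmong-∷-new l u Ru _ (trans (Routed.same-vertex rt) ιi≡u)) c'≡c
    where
    rt : Routed H M i (σ⁻¹ M i (c u))
    rt = route sy M i (σ⁻¹ M i (c u))
    c'≡c : ∀ u' → DeleteStep.R' (Routed.M' rt) i (Routed.t' rt) u' ≡ true →
      DeleteStep.c' (Routed.M' rt) i (Routed.t' rt) u' ≡ c u'
    c'≡c u' _ with eqb u' (ι (Routed.M' rt) i) in u'≟
    ... | false = refl
    ... | true = begin
      σ (Routed.M' rt) i (Routed.t' rt)   ≡⟨ Routed.same-element rt ⟩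
      σ M i (σ⁻¹ M i (c u))               ≡⟨ σ-σ⁻¹ M i (c u) ⟩
      c u
        ≡⟨ cong c (sym (trans (eqb-true u'≟) (trans (Routed.same-vertex rt) ιi≡u))) ⟩
      c u'                                ∎
      where open ≡-Reasoning

  stage : ∀ l → Stage l
  stage [] = n , G , start , syG , MinorModel-cong (MinorModel-start G) (λ u → sym (∧-zeroʳ (R u))) λ _ ()
  stage (u ∷ l) with stage l
  ... | m , H , r , sy , M with R u in Ru
  ...   | false = m , H , r , sy ,
            MinorModel-cong M (removedAmong-∷ l u (trans (cong (_∧ any (eqb u) l) Ru) (sym Ru))) λ _ _ → refl
  ...   | true with removedAmong l u in done
  ...     | true = m , H , r , sy , MinorModel-cong M (removedAmong-∷ l u (trans done (sym Ru))) λ _ _ → refl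
  ...     | false with ι-onto M u done
  ...       | i , ιi≡u = remove {l} r sy M Ru i ιi≡u

  reachable : Σ ℕ λ m → Σ (Graph m) λ H → Reach G m H × MinorModel G H R c
  reachable with stage (allFin n)
  ... | m , H , r , _ , M = m , H , r , MinorModel-cong M all-removed λ _ _ → refl
    where
    all-removed : removedAmong (allFin n) ≐ R
    all-removed u = trans (cong (R u ∧_) (any-eqb-∈ (∈-allFin u))) (∧-identityʳ (R u))

IsoIAS⇒IsoMinor : ∀ {n m} {G : Graph n} {H : Graph m} {R c} (M : Matroid) → MinorModel G H R c →
  IsoIAS M H → IsoMinor M G R c
IsoIAS⇒IsoMinor {G = G} {R = R} {c} M Mo (g , g-inj , _ , g-onto , g-indep) =
  h Mo ∘ g , (λ i j p → g-inj i j (h-injective Mo _ _ p)) , h-remaining Mo ∘ g , onto , indep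
  where
  onto : ∀ e → remaining R e ≡ true → Σ (Fin (size M)) λ i → h Mo (g i) ≡ e
  onto e re with h-onto Mo e re
  ... | e' , he'≡e with g-onto e' refl
  ...   | i , gi≡e' = i , trans (cong (h Mo) gi≡e') he'≡e
  indep : ∀ T → T ⊆ remaining R →
    (MinorIndep G R c T → Indep M (T ∘ h Mo ∘ g)) × (Indep M (T ∘ h Mo ∘ g) → MinorIndep G R c T)
  indep T T⊆ =
    (λ mi → proj₁ (g-indep (T ∘ h Mo) (λ _ _ → refl))
              (modulo⇒indep Mo T T⊆ (IAS.ContrIndep⇒IndepModulo G (remaining-disjoint T⊆) mi))) ,
    (λ ind → IAS.IndepModulo⇒ContrIndep G
               (indep⇒modulo Mo T T⊆ (proj₂ (g-indep (T ∘ h Mo) (λ _ _ → refl)) ind)))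

IsoMinor⇒IsoIAS : ∀ {n m} {G : Graph n} {H : Graph m} {R c} (M : Matroid) → MinorModel G H R c →
  IsoMinor M G R c → IsoIAS M H
IsoMinor⇒IsoIAS {n} {m} {G} {H} {R} {c} M Mo (g , g-inj , g-remaining , g-onto , g-indep) =
  g' , g'-inj , (λ _ → refl) , g'-onto , indep
  where
  g' : Fin (size M) → Elt m
  g' i = proj₁ (h-onto Mo (g i) (g-remaining i))
  hg' : ∀ i → h Mo (g' i) ≡ g i
  hg' i = proj₂ (h-onto Mo (g i) (g-remaining i))
  g'-inj : ∀ i j → g' i ≡ g' j → i ≡ j
  g'-inj i j p = g-inj i j (trans (sym (hg' i)) (trans (cong (h Mo) p) (hg' j)))
  g'-onto : ∀ e → true ≡ true → Σ (Fin (size M)) λ i → g' i ≡ e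
  g'-onto e _ with g-onto (h Mo e) (h-remaining Mo e)
  ... | i , gi≡he = i , h-injective Mo _ _ (trans (hg' i) gi≡he)
  pullback-g : ∀ T i → pullback Mo T (g i) ≡ T (g' i)
  pullback-g T i = trans (cong (pullback Mo T) (sym (hg' i))) (pullback-h Mo T (g' i))
  indep : ∀ T → T ⊆ (λ _ → true) → (IASIndep H T → Indep M (T ∘ g')) × (Indep M (T ∘ g') → IASIndep H T)
  indep T _ = to , from
    where
    T̂ : Sub (Elt n)
    T̂ = pullback Mo T
    T̂⊆ : T̂ ⊆ remaining R
    T̂⊆ = pullback-remaining Mo T
    to : IASIndep H T → Indep M (T ∘ g')
    to ind = indep-⊆ M (T̂ ∘ g) (T ∘ g') (⊆-≐ (sym ∘ pullback-g T))
      (proj₁ (g-indep T̂ T̂⊆) (IAS.IndepModulo⇒ContrIndep G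
        (indep⇒modulo Mo T̂ T̂⊆ (IAS.Independent-⊆ H (⊆-≐ (pullback-h Mo T)) ind))))
    from : Indep M (T ∘ g') → IASIndep H T
    from ind = IAS.Independent-⊆ H (⊆-≐ (sym ∘ pullback-h Mo T))
      (modulo⇒indep Mo T̂ T̂⊆ (IAS.ContrIndep⇒IndepModulo G (remaining-disjoint T̂⊆)
        (proj₂ (g-indep T̂ T̂⊆) (indep-⊆ M (T ∘ g') (T̂ ∘ g) (⊆-≐ (pullback-g T)) ind))))

theorem39 : {n : ℕ} (G : Graph n) → IsLoopedSimple G →
  (M : Matroid) → IsBinary M →
  ((Σ ℕ λ m → Σ (Graph m) λ H → Reach G m H × IsoIAS M H) →
     Σ (Sub (Fin n)) λ R → Σ (Fin n → Lbl) λ c → IsoMinor M G R c)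
  × ((Σ (Sub (Fin n)) λ R → Σ (Fin n → Lbl) λ c → IsoMinor M G R c) →
     Σ ℕ λ m → Σ (Graph m) λ H → Reach G m H × IsoIAS M H)
theorem39 G sy M _ =
  (λ (_ , _ , r , iso) →
     let R , c , model = Reach⇒MinorModel sy r in R , c , IsoIAS⇒IsoMinor M model iso) ,
  (λ (R , c , iso) →
     let m , H , r , model = RemoveCells.reachable G sy R c in m , H , r , IsoMinor⇒IsoIAS M model iso)
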